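{- Let $c\ge 0$ and $f\ge 1$ be integers, let $M\colon\{1,\dots,c\}\to\{1,\dots,c+f\}$ be a uniformly random injective map, and let $R$ be the number of requests made by the faithful man Mr.~$c+1$ (as defined in the context). Then the third central moment of $R$ is \[ \frac{(c+f+1)cf\,(2cf+f^2-2c-1)}{(f+1)^3(f+2)(f+3)} \] and the fourth central moment of $R$ is \[ \frac{(c+f+1)cf\,\bigl(9c^2f^2+9cf^3+f^4-3c^2f+6cf^2-3f^3+6c^2+3cf-9f^2+6c-5f\bigr)}{(f+1)^4(f+2)(f+3)(f+4)} . \]
   Context: Model: there are men Mr.~$1,\dots,$ Mr.~$c+f$ and women Mrs.~$1,\dots,$ Mrs.~$c+f$, Mr.~$j$ married to Mrs.~$j$. Men $1,\dots,c$ are "cheating", men $c+1,\dots,c+f$ "faithful". Mrs.~$M(j)$ is the mistress of Mr.~$j$ ($1\le j\le c$), and Mr.~$j$ is the lover of Mrs.~$M(j)$. A woman is faithful iff she is not in the image of $M$. A faithful man $m$ first asks his wife Mrs.~$m$; whenever he asks Mrs.~$w$, if $w\notin M(\{1,\dots,c\})$ she accepts and he stops, otherwise he next asks Mrs.~$M^{ -1}(w)$. His number of requests is the total number of women he asks, including the accepting one. -}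

module Defs where

open import Data.Bool using (Bool; true; false; _∧_; if_then_else_)
open import Data.Nat as ℕ using (ℕ; zero; suc)
open import Data.Fin as Fin using (Fin; toℕ; _≟_)
open import Data.Fin.Base using () renaming (zero to fz; suc to fs)
open import Data.List as List using (List; []; _∷_; [_]; allFin; concatMap; filterᵇ; length)
open import Data.Maybe using (Maybe; just; nothing)
open import Data.Integer as ℤ using (ℤ; +_)
open import Data.Rational as ℚ using (ℚ; _/_)
open import Relation.Nullary.Decidable using (⌊_⌋)

-- Indices are 0-based: Mr./Mrs. i+1 of the paper is index i.
-- Cheating men: 0..c-1 ; faithful men: c..c+f-1.
-- A mistress map is M : Fin c → Fin (c + f).

cons : ∀ {c n} → Fin n → (Fin c → Fin n) → (Fin (suc c) → Fin n)
cons a g fz     = a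
cons a g (fs i) = g i

allFuns : (c n : ℕ) → List (Fin c → Fin n)
allFuns zero    n = [ (λ ()) ]
allFuns (suc c) n = concatMap (λ g → List.map (λ a → cons a g) (allFin n)) (allFuns c n)

allᵇ : ∀ {A : Set} → (A → Bool) → List A → Bool
allᵇ p []       = true
allᵇ p (x ∷ xs) = p x ∧ allᵇ p xs

injectiveᵇ : ∀ {c n} → (Fin c → Fin n) → Bool
injectiveᵇ {c} M =
  allᵇ (λ i → allᵇ (λ j → if ⌊ M i ≟ M j ⌋ then ⌊ i ≟ j ⌋ else true) (allFin c)) (allFin c)

-- all injective maps Fin c → Fin n, the sample space (uniform distribution)
injections : (c n : ℕ) → List (Fin c → Fin n)
injections c n = filterᵇ injectiveᵇ (allFuns c n)

preimage : ∀ {c n} → (Fin c → Fin n) → ℕ → Maybe (Fin c)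
preimage {zero}  M w = nothing
preimage {suc c} M w with ⌊ toℕ (M fz) ℕ.≟ w ⌋
... | true  = just fz
... | false = Data.Maybe.map fs (preimage (λ i → M (fs i)) w)
  where import Data.Maybe

chain : ∀ {c n} → (Fin c → Fin n) → (fuel : ℕ) → ℕ → ℕ
chain M zero       w = zero
chain M (suc fuel) w with preimage M w
... | nothing = 1
... | just j  = suc (chain M fuel (toℕ j))

-- Number of requests of faithful man with index m (he first asks his wife Mrs. m).
-- At most c+1 women are asked (the chain visits distinct cheating men's wives),
-- so fuel c+1 is sufficient.
requests : ∀ {c n} → (Fin c → Fin n) → ℕ → ℕ
requests {c} M m = chain M (suc c) m

R : (c f : ℕ) → (Fin c → Fin (c ℕ.+ f)) → ℚ
R c f M = + (requests M c) / 1

sumℚ : List ℚ → ℚ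
sumℚ = List.foldr ℚ._+_ ℚ.0ℚ

average : List ℚ → ℚ
average []       = ℚ.0ℚ
average (x ∷ xs) = sumℚ (x ∷ xs) ℚ.* (+ 1 / suc (length xs))

powℚ : ℚ → ℕ → ℚ
powℚ q zero    = ℚ.1ℚ
powℚ q (suc k) = q ℚ.* powℚ q k

meanR : (c f : ℕ) → ℚ
meanR c f = average (List.map (R c f) (injections c (c ℕ.+ f)))

centralMomentR : (k c f : ℕ) → ℚ
centralMomentR k c f =
  average (List.map (λ M → powℚ (R c f M ℚ.- meanR c f) k) (injections c (c ℕ.+ f)))

z : ℕ → ℤ
z n = + n

inv : (n : ℕ) → ℚ
inv n = + 1 / suc n     -- inv n = 1/(n+1)

third : (c f : ℕ) → ℚ
third c f =
  ((z (c ℕ.+ f ℕ.+ 1) ℤ.* z c ℤ.* z f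
     ℤ.* (z 2 ℤ.* z c ℤ.* z f ℤ.+ z f ℤ.* z f ℤ.- z 2 ℤ.* z c ℤ.- z 1)) / 1)
  ℚ.* powℚ (inv f) 3 ℚ.* inv (suc f) ℚ.* inv (suc (suc f))

fourth : (c f : ℕ) → ℚ
fourth c f =
  ((z (c ℕ.+ f ℕ.+ 1) ℤ.* z c ℤ.* z f
     ℤ.* ( z 9 ℤ.* C ℤ.* C ℤ.* F ℤ.* F ℤ.+ z 9 ℤ.* C ℤ.* F ℤ.* F ℤ.* F ℤ.+ F ℤ.* F ℤ.* F ℤ.* F
         ℤ.- z 3 ℤ.* C ℤ.* C ℤ.* F ℤ.+ z 6 ℤ.* C ℤ.* F ℤ.* F ℤ.- z 3 ℤ.* F ℤ.* F ℤ.* F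
         ℤ.+ z 6 ℤ.* C ℤ.* C ℤ.+ z 3 ℤ.* C ℤ.* F ℤ.- z 9 ℤ.* F ℤ.* F
         ℤ.+ z 6 ℤ.* C ℤ.- z 5 ℤ.* F)) / 1)
  ℚ.* powℚ (inv f) 4 ℚ.* inv (suc f) ℚ.* inv (suc (suc f)) ℚ.* inv (suc (suc (suc f)))
  where
  C = z c
  F = z f

{-# OPTIONS --safe #-}
module Submission where

-- Write x ↑ j = x (x+1) ⋯ (x+j-1). Take Mr. 1 out of the cheating men and let his mistress a range
-- over the women who are nobody else's mistress: every walk of requests stays the same, except the one
-- accepted by a (if any), which now continues with the walk starting at Mr. 1's wife. The resulting
-- recursion in c shows that for distinct starting women S, none of them a cheater's wife, the total
-- number T of requests made from S satisfies ∑_M T ↑ j = |S| ↑ j · (m+j+1) ↑ c, the sum running over all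
-- injections M : {1..c} → {1..c+m}. For S = {Mrs. c+1} this gives E[R ↑ j] = j! (c+f+1) ↑ j / (f+1) ↑ j.
-- Since (f+1) R − (c+f+1) = (f+1) (R − E R), expanding its k-th power in the basis R ↑ j expresses the
-- k-th central moment through these rising moments, and clearing the denominators (f+1) ↑ j leaves a
-- polynomial identity.

open import Level using (0ℓ)
open import Algebra.Bundles using (CommutativeSemiring; CommutativeRing)
open import Data.List using (List; []; _∷_; _++_; map; foldr; concatMap; allFin; filterᵇ; length)
open import Data.List.Relation.Unary.All as All using (All; []; _∷_)

module ListSum (R : CommutativeSemiring 0ℓ 0ℓ) where

  open CommutativeSemiring R
  open import Algebra.Properties.CommutativeSemigroup +-commutativeSemigroup using (interchange)
  open import Relation.Binary.Reasoning.Setoid setoid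

  private variable A B : Set

  ∑ : (A → Carrier) → List A → Carrier
  ∑ f xs = foldr _+_ 0# (map f xs)

  ∑-zero : (xs : List A) → ∑ (λ _ → 0#) xs ≈ 0#
  ∑-zero []       = refl
  ∑-zero (x ∷ xs) = trans (+-congˡ (∑-zero xs)) (+-identityˡ 0#)

  ∑-cong : {f g : A → Carrier} → (∀ x → f x ≈ g x) → ∀ xs → ∑ f xs ≈ ∑ g xs
  ∑-cong f≈g []       = refl
  ∑-cong f≈g (x ∷ xs) = +-cong (f≈g x) (∑-cong f≈g xs)

  ∑-cong-All : {f g : A → Carrier} {xs : List A} → All (λ x → f x ≈ g x) xs → ∑ f xs ≈ ∑ g xs
  ∑-cong-All []         = refl
  ∑-cong-All (eq ∷ eqs) = +-cong eq (∑-cong-All eqs)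

  ∑-+ : ∀ (f g : A → Carrier) xs → ∑ (λ x → f x + g x) xs ≈ ∑ f xs + ∑ g xs
  ∑-+ f g []       = sym (+-identityˡ 0#)
  ∑-+ f g (x ∷ xs) = begin
    (f x + g x) + ∑ (λ x → f x + g x) xs ≈⟨ +-congˡ (∑-+ f g xs) ⟩
    (f x + g x) + (∑ f xs + ∑ g xs)      ≈⟨ interchange (f x) (g x) (∑ f xs) (∑ g xs) ⟩
    (f x + ∑ f xs) + (g x + ∑ g xs)      ∎

  ∑-*ˡ : ∀ k (f : A → Carrier) xs → ∑ (λ x → k * f x) xs ≈ k * ∑ f xs
  ∑-*ˡ k f []       = sym (zeroʳ k)
  ∑-*ˡ k f (x ∷ xs) = trans (+-congˡ (∑-*ˡ k f xs)) (sym (distribˡ k (f x) (∑ f xs)))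

  ∑-*ʳ : ∀ k (f : A → Carrier) xs → ∑ (λ x → f x * k) xs ≈ ∑ f xs * k
  ∑-*ʳ k f xs = trans (∑-cong (λ x → *-comm (f x) k) xs) (trans (∑-*ˡ k f xs) (*-comm k (∑ f xs)))

  ∑-++ : ∀ (f : A → Carrier) xs ys → ∑ f (xs ++ ys) ≈ ∑ f xs + ∑ f ys
  ∑-++ f []       ys = sym (+-identityˡ (∑ f ys))
  ∑-++ f (x ∷ xs) ys = trans (+-congˡ (∑-++ f xs ys)) (sym (+-assoc (f x) (∑ f xs) (∑ f ys)))

  ∑-map : ∀ (f : B → Carrier) (h : A → B) xs → ∑ f (map h xs) ≈ ∑ (λ x → f (h x)) xs
  ∑-map f h []       = refl
  ∑-map f h (x ∷ xs) = +-congˡ (∑-map f h xs)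

  ∑-concatMap : ∀ (f : B → Carrier) (h : A → List B) xs → ∑ f (concatMap h xs) ≈ ∑ (λ x → ∑ f (h x)) xs
  ∑-concatMap f h []       = refl
  ∑-concatMap f h (x ∷ xs) = trans (∑-++ f (h x) (concatMap h xs)) (+-congˡ (∑-concatMap f h xs))

  ∑-swap : ∀ (f : A → B → Carrier) xs ys → ∑ (λ x → ∑ (f x) ys) xs ≈ ∑ (λ y → ∑ (λ x → f x y) xs) ys
  ∑-swap f []       ys = sym (∑-zero ys)
  ∑-swap f (x ∷ xs) ys = begin
    ∑ (f x) ys + ∑ (λ x → ∑ (f x) ys) xs          ≈⟨ +-congˡ (∑-swap f xs ys) ⟩
    ∑ (f x) ys + ∑ (λ y → ∑ (λ x → f x y) xs) ys  ≈⟨ sym (∑-+ (f x) (λ y → ∑ (λ x → f x y) xs) ys) ⟩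
    ∑ (λ y → f x y + ∑ (λ x → f x y) xs) ys       ∎

open import Defs
open import Data.Nat using (ℕ; zero; suc; _≤_)
open import Data.Fin using (Fin) renaming (zero to fz; suc to fs)
open import Data.Product using (∃; _×_; _,_; proj₁; proj₂)
open import Function using (_∘_; _⇔_; mk⇔; Equivalence)
open import Function.Definitions using (Injective)
open import Relation.Binary.PropositionalEquality
  using (_≡_; _≢_; refl; sym; trans; cong; cong₂; subst; subst₂; module ≡-Reasoning)

module Counting where

  open import Data.Bool using (Bool; true; false; T; if_then_else_)
  open import Data.Bool.Properties using (T-∧)
  open import Data.Empty using (⊥-elim)
  open import Data.Fin using (toℕ; _≟_; _↑ˡ_; fromℕ<)
  open import Data.Fin.Properties using (all?; toℕ-injective; toℕ-↑ˡ; toℕ<n; toℕ-fromℕ<)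
    renaming (suc-injective to fs-injective)
  open import Data.List.Properties using (map-tabulate; length-tabulate)
  open import Data.List.Relation.Unary.All.Properties using (all-filter; tabulate⁺; tabulate⁻)
  open import Data.List.Relation.Unary.AllPairs using ([]; _∷_)
  open import Data.List.Relation.Unary.Unique.Propositional using (Unique)
  open import Data.Maybe as Maybe using (Maybe; just; nothing; maybe′)
  import Data.Maybe.Properties as MaybeP
  open import Data.Nat as ℕ using (_+_; _*_; z≤n; s≤s)
  import Data.Nat.Properties as ℕP
  open import Data.Nat.Tactic.RingSolver using (solve-∀)
  open import Data.Unit using (tt)
  open import Relation.Nullary using (¬_; Dec; yes; no; ¬?)
  open import Relation.Nullary.Decidable using (⌊_⌋; T?; toWitness; fromWitness)

  open ListSum ℕP.+-*-commutativeSemiring public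

  χ : Bool → ℕ
  χ true  = 1
  χ false = 0

  χ-yes : ∀ {p} {P : Set p} (P? : Dec P) → P → χ ⌊ P? ⌋ ≡ 1
  χ-yes (yes _) _ = refl
  χ-yes (no ¬p) p = ⊥-elim (¬p p)

  χ-no : ∀ {p} {P : Set p} (P? : Dec P) → ¬ P → χ ⌊ P? ⌋ ≡ 0
  χ-no (yes p) ¬p = ⊥-elim (¬p p)
  χ-no (no _)  _  = refl

  χ-cong : ∀ {p q} {P : Set p} {Q : Set q} (P? : Dec P) (Q? : Dec Q) → P ⇔ Q → χ ⌊ P? ⌋ ≡ χ ⌊ Q? ⌋
  χ-cong (yes p) Q? P⇔Q = sym (χ-yes Q? (Equivalence.to P⇔Q p))
  χ-cong (no ¬p) Q? P⇔Q = sym (χ-no Q? (¬p ∘ Equivalence.from P⇔Q))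

  χ-⇔ : ∀ {b b₁ b₂} → T b ⇔ (T b₁ × T b₂) → χ b ≡ χ b₁ * χ b₂
  χ-⇔ {true}  {true}  {true}  _ = refl
  χ-⇔ {true}  {true}  {false} e = ⊥-elim (proj₂ (Equivalence.to e tt))
  χ-⇔ {true}  {false} {_}     e = ⊥-elim (proj₁ (Equivalence.to e tt))
  χ-⇔ {false} {true}  {true}  e = ⊥-elim (Equivalence.from e (tt , tt))
  χ-⇔ {false} {true}  {false} _ = refl
  χ-⇔ {false} {false} {_}     _ = refl

  ∑-const-1 : ∀ {A : Set} (xs : List A) → ∑ (λ _ → 1) xs ≡ length xs
  ∑-const-1 []       = refl
  ∑-const-1 (x ∷ xs) = cong suc (∑-const-1 xs)

  ∑-filterᵇ : ∀ {A : Set} (h : A → ℕ) (p : A → Bool) xs → ∑ h (filterᵇ p xs) ≡ ∑ (λ x → χ (p x) * h x) xs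
  ∑-filterᵇ h p []       = refl
  ∑-filterᵇ h p (x ∷ xs) with p x
  ... | true  = cong₂ _+_ (sym (ℕP.+-identityʳ (h x))) (∑-filterᵇ h p xs)
  ... | false = ∑-filterᵇ h p xs

  δ : ∀ {n} → Fin n → Fin n → ℕ
  δ a b = χ ⌊ a ≟ b ⌋

  ∑-allFin-suc : ∀ {n} (h : Fin (suc n) → ℕ) → ∑ h (allFin (suc n)) ≡ h fz + ∑ (h ∘ fs) (allFin n)
  ∑-allFin-suc {n} h = cong (h fz +_) (trans (cong (∑ h) (sym (map-tabulate (λ i → i) fs))) (∑-map h fs (allFin n)))

  ∑-δ : ∀ {n} (w : Fin n → ℕ) b → ∑ (λ a → w a * δ a b) (allFin n) ≡ w b
  ∑-δ {suc n} w fz = begin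
    ∑ (λ a → w a * δ a fz) (allFin (suc n))
      ≡⟨ ∑-allFin-suc (λ a → w a * δ a fz) ⟩
    w fz * 1 + ∑ (λ a → w (fs a) * 0) (allFin n)
      ≡⟨ cong₂ _+_ (ℕP.*-identityʳ (w fz)) (∑-cong (λ a → ℕP.*-zeroʳ (w (fs a))) (allFin n)) ⟩
    w fz + ∑ (λ _ → 0) (allFin n)
      ≡⟨ trans (cong (w fz +_) (∑-zero (allFin n))) (ℕP.+-identityʳ (w fz)) ⟩
    w fz ∎
    where open ≡-Reasoning
  ∑-δ {suc n} w (fs b) = begin
    ∑ (λ a → w a * δ a (fs b)) (allFin (suc n))
      ≡⟨ ∑-allFin-suc (λ a → w a * δ a (fs b)) ⟩
    w fz * 0 + ∑ (λ a → w (fs a) * δ (fs a) (fs b)) (allFin n)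
      ≡⟨ cong₂ _+_ (ℕP.*-zeroʳ (w fz)) (∑-cong δ-fs (allFin n)) ⟩
    ∑ (λ a → w (fs a) * δ a b) (allFin n)
      ≡⟨ ∑-δ (w ∘ fs) b ⟩
    w (fs b) ∎
    where
    open ≡-Reasoning
    δ-fs : ∀ a → w (fs a) * δ (fs a) (fs b) ≡ w (fs a) * δ a b
    δ-fs a = cong (w (fs a) *_) (χ-cong (fs a ≟ fs b) (a ≟ b) (mk⇔ fs-injective (cong fs)))

  ∑-δ-absent : ∀ {n} {a : Fin n} {bs} → All (a ≢_) bs → ∑ (δ a) bs ≡ 0
  ∑-δ-absent []                       = refl
  ∑-δ-absent {a = a} {b ∷ _} (a≢b ∷ a∉bs) = cong₂ _+_ (χ-no (a ≟ b) a≢b) (∑-δ-absent a∉bs)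

  ∑-δ-unique : ∀ {n} (a : Fin n) {bs} → Unique bs → ∑ (δ a) bs ≤ 1
  ∑-δ-unique a {[]}     []              = z≤n
  ∑-δ-unique a {b ∷ bs} (b∉bs ∷ unique) with a ≟ b
  ... | yes refl = ℕP.≤-reflexive (cong (1 +_) (∑-δ-absent b∉bs))
  ... | no  _    = ∑-δ-unique a unique

  T-allᵇ : ∀ {A : Set} (p : A → Bool) xs → T (allᵇ p xs) ⇔ All (T ∘ p) xs
  T-allᵇ p []       = mk⇔ (λ _ → []) (λ _ → tt)
  T-allᵇ p (x ∷ xs) = mk⇔
    (λ t → let (px , pxs) = Equivalence.to T-∧ t in px ∷ Equivalence.to (T-allᵇ p xs) pxs)
    (λ { (px ∷ pxs) → Equivalence.from T-∧ (px , Equivalence.from (T-allᵇ p xs) pxs) })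

  T-allᵇ-allFin : ∀ {n} (p : Fin n → Bool) → T (allᵇ p (allFin n)) ⇔ (∀ i → T (p i))
  T-allᵇ-allFin {n} p =
    mk⇔ (tabulate⁻ ∘ Equivalence.to (T-allᵇ p (allFin n))) (Equivalence.from (T-allᵇ p (allFin n)) ∘ tabulate⁺)

  T-implication : ∀ {p q} {P : Set p} {Q : Set q} (P? : Dec P) (Q? : Dec Q) →
                  T (if ⌊ P? ⌋ then ⌊ Q? ⌋ else true) ⇔ (P → Q)
  T-implication (yes p) (yes q) = mk⇔ (λ _ _ → q) (λ _ → tt)
  T-implication (yes p) (no ¬q) = mk⇔ (λ ()) (λ p⇒q → ¬q (p⇒q p))
  T-implication (no ¬p) Q?      = mk⇔ (λ _ p → ⊥-elim (¬p p)) (λ _ → tt)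

  T-injectiveᵇ : ∀ {c n} (M : Fin c → Fin n) → T (injectiveᵇ M) ⇔ Injective _≡_ _≡_ M
  T-injectiveᵇ M = mk⇔
    (λ t {i} {j} → Equivalence.to (T-implication (M i ≟ M j) (i ≟ j))
                     (Equivalence.to (T-allᵇ-allFin _) (Equivalence.to (T-allᵇ-allFin _) t i) j))
    (λ inj → Equivalence.from (T-allᵇ-allFin _) λ i → Equivalence.from (T-allᵇ-allFin _) λ j →
               Equivalence.from (T-implication (M i ≟ M j) (i ≟ j)) inj)

  injections-injective : ∀ c n → All (Injective _≡_ _≡_) (injections c n)
  injections-injective c n = All.map (Equivalence.to (T-injectiveᵇ _)) (all-filter (T? ∘ injectiveᵇ) (allFuns c n))

  infix 4 _∉img_ _∉img?_

  _∉img_ : ∀ {c n} → Fin n → (Fin c → Fin n) → Set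
  a ∉img g = ∀ j → g j ≢ a

  _∉img?_ : ∀ {c n} (a : Fin n) (g : Fin c → Fin n) → Dec (a ∉img g)
  a ∉img? g = all? (λ j → ¬? (g j ≟ a))

  ∉img-suc : ∀ {c n} {a : Fin n} {g : Fin (suc c) → Fin n} → a ∉img g ⇔ (g fz ≢ a × a ∉img (g ∘ fs))
  ∉img-suc = mk⇔ (λ a∉g → a∉g fz , a∉g ∘ fs) (λ { (g₀≢a , _) fz → g₀≢a ; (_ , a∉g′) (fs j) → a∉g′ j })

  cons-injective : ∀ {c n} (a : Fin n) (g : Fin c → Fin n) →
                   Injective _≡_ _≡_ (cons a g) ⇔ (Injective _≡_ _≡_ g × a ∉img g)
  cons-injective a g = mk⇔ to from
    where
    to : Injective _≡_ _≡_ (cons a g) → Injective _≡_ _≡_ g × a ∉img g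
    to inj = fs-injective ∘ inj , λ j e → fs≢fz (inj {fs j} {fz} e)
      where
      fs≢fz : ∀ {c} {j : Fin c} → fs j ≢ fz
      fs≢fz ()
    from : Injective _≡_ _≡_ g × a ∉img g → Injective _≡_ _≡_ (cons a g)
    from (inj , a∉g) {fz}   {fz}   _ = refl
    from (inj , a∉g) {fz}   {fs j} e = ⊥-elim (a∉g j (sym e))
    from (inj , a∉g) {fs i} {fz}   e = ⊥-elim (a∉g i e)
    from (inj , a∉g) {fs i} {fs j} e = cong fs (inj e)

  χ-injectiveᵇ-cons : ∀ {c n} (a : Fin n) (g : Fin c → Fin n) →
                      χ (injectiveᵇ (cons a g)) ≡ χ (injectiveᵇ g) * χ ⌊ a ∉img? g ⌋
  χ-injectiveᵇ-cons a g = χ-⇔ (mk⇔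
    (λ t → let (inj , a∉g) = Equivalence.to (cons-injective a g) (Equivalence.to (T-injectiveᵇ (cons a g)) t)
           in Equivalence.from (T-injectiveᵇ g) inj , fromWitness a∉g)
    (λ (t , a∉g) → Equivalence.from (T-injectiveᵇ (cons a g))
                     (Equivalence.from (cons-injective a g) (Equivalence.to (T-injectiveᵇ g) t , toWitness a∉g))))

  ∑-injections-suc : ∀ c n (h : (Fin (suc c) → Fin n) → ℕ) →
    ∑ h (injections (suc c) n) ≡ ∑ (λ g → ∑ (λ a → χ ⌊ a ∉img? g ⌋ * h (cons a g)) (allFin n)) (injections c n)
  ∑-injections-suc c n h = begin
    ∑ h (injections (suc c) n)
      ≡⟨ ∑-filterᵇ h injectiveᵇ (allFuns (suc c) n) ⟩
    ∑ (λ M → χ (injectiveᵇ M) * h M) (concatMap (λ g → map (λ a → cons a g) (allFin n)) (allFuns c n))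
      ≡⟨ ∑-concatMap _ _ (allFuns c n) ⟩
    ∑ (λ g → ∑ (λ M → χ (injectiveᵇ M) * h M) (map (λ a → cons a g) (allFin n))) (allFuns c n)
      ≡⟨ ∑-cong (λ g → trans (∑-map _ _ (allFin n)) (∑-cong (split g) (allFin n))) (allFuns c n) ⟩
    ∑ (λ g → ∑ (λ a → χ (injectiveᵇ g) * (χ ⌊ a ∉img? g ⌋ * h (cons a g))) (allFin n)) (allFuns c n)
      ≡⟨ ∑-cong (λ g → ∑-*ˡ (χ (injectiveᵇ g)) _ (allFin n)) (allFuns c n) ⟩
    ∑ (λ g → χ (injectiveᵇ g) * ∑ (λ a → χ ⌊ a ∉img? g ⌋ * h (cons a g)) (allFin n)) (allFuns c n)
      ≡⟨ ∑-filterᵇ _ injectiveᵇ (allFuns c n) ⟨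
    ∑ (λ g → ∑ (λ a → χ ⌊ a ∉img? g ⌋ * h (cons a g)) (allFin n)) (injections c n) ∎
    where
    open ≡-Reasoning
    split : ∀ g a → χ (injectiveᵇ (cons a g)) * h (cons a g) ≡ χ (injectiveᵇ g) * (χ ⌊ a ∉img? g ⌋ * h (cons a g))
    split g a = trans (cong (_* h (cons a g)) (χ-injectiveᵇ-cons a g)) (ℕP.*-assoc (χ (injectiveᵇ g)) _ _)

  ∑-χ-∉img : ∀ {c n} (g : Fin c → Fin n) → Injective _≡_ _≡_ g →
             ∑ (λ a → χ ⌊ a ∉img? g ⌋) (allFin n) + c ≡ n
  ∑-χ-∉img {zero} {n} g _ = begin
    ∑ (λ a → χ ⌊ a ∉img? g ⌋) (allFin n) + 0  ≡⟨ ℕP.+-identityʳ _ ⟩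
    ∑ (λ a → χ ⌊ a ∉img? g ⌋) (allFin n)      ≡⟨ ∑-cong (λ a → χ-yes (a ∉img? g) (λ ())) (allFin n) ⟩
    ∑ (λ _ → 1) (allFin n)                     ≡⟨ ∑-const-1 (allFin n) ⟩
    length (allFin n)                          ≡⟨ length-tabulate (λ i → i) ⟩
    n                                          ∎
    where open ≡-Reasoning
  ∑-χ-∉img {suc c} {n} g inj = begin
    ∑ w (allFin n) + suc c
      ≡⟨ ℕP.+-assoc _ 1 c ⟨
    ∑ w (allFin n) + 1 + c
      ≡⟨ cong (λ k → ∑ w (allFin n) + k + c) g₀∉g′ ⟨
    ∑ w (allFin n) + ∑ (λ a → w′ a * δ a (g fz)) (allFin n) + c
      ≡⟨ cong (_+ c) (trans (sym (∑-+ w _ (allFin n))) (∑-cong split (allFin n))) ⟩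
    ∑ w′ (allFin n) + c
      ≡⟨ ∑-χ-∉img (g ∘ fs) (fs-injective ∘ inj) ⟩
    n ∎
    where
    open ≡-Reasoning
    w w′ : Fin n → ℕ
    w  a = χ ⌊ a ∉img? g ⌋
    w′ a = χ ⌊ a ∉img? (g ∘ fs) ⌋
    g₀∉g′ : ∑ (λ a → w′ a * δ a (g fz)) (allFin n) ≡ 1
    g₀∉g′ = trans (∑-δ w′ (g fz)) (χ-yes (g fz ∉img? (g ∘ fs)) (λ j e → fs≢fz (inj {fs j} {fz} e)))
      where
      fs≢fz : ∀ {j : Fin c} → fs j ≢ fz
      fs≢fz ()
    split : ∀ a → w a + w′ a * δ a (g fz) ≡ w′ a
    split a with a ≟ g fz
    ... | yes refl = trans (cong (_+ w′ a * 1) (χ-no (a ∉img? g) (λ a∉g → a∉g fz refl))) (ℕP.*-identityʳ (w′ a))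
    ... | no a≢g₀  = trans (cong (w a +_) (ℕP.*-zeroʳ (w′ a))) (trans (ℕP.+-identityʳ (w a))
        (χ-cong (a ∉img? g) (a ∉img? (g ∘ fs))
          (mk⇔ (proj₂ ∘ Equivalence.to ∉img-suc) (λ a∉g′ → Equivalence.from ∉img-suc (a≢g₀ ∘ sym , a∉g′)))))

  -- s x ≡ just y: Mrs. x sends the man asking her on to Mrs. y; s x ≡ nothing: she accepts him.
  module _ {A : Set} (s : A → Maybe A) where

    walkLength : ℕ → A → ℕ
    walkLength zero       x = 0
    walkLength (suc fuel) x = maybe′ (λ y → suc (walkLength fuel y)) 1 (s x)

    walkEnd : ℕ → A → A
    walkEnd zero       x = x
    walkEnd (suc fuel) x = maybe′ (walkEnd fuel) x (s x)

    data Walk : A → ℕ → A → Set where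
      stop : ∀ {x} → s x ≡ nothing → Walk x 1 x
      _∷_  : ∀ {x y k t} → s x ≡ just y → Walk y k t → Walk x (suc k) t

    walk⇒walkLength : ∀ {x k t fuel} → Walk x k t → k ≤ fuel → walkLength fuel x ≡ k
    walk⇒walkLength {x} {fuel = suc _} (stop e) _        rewrite e = refl
    walk⇒walkLength {x} {fuel = suc _} (e ∷ w)  (s≤s k≤) rewrite e = cong suc (walk⇒walkLength w k≤)

    walk⇒walkEnd : ∀ {x k t fuel} → Walk x k t → k ≤ fuel → walkEnd fuel x ≡ t
    walk⇒walkEnd {x} {fuel = suc _} (stop e) _        rewrite e = refl
    walk⇒walkEnd {x} {fuel = suc _} (e ∷ w)  (s≤s k≤) rewrite e = walk⇒walkEnd w k≤

    walk-accepted : ∀ {x k t} → Walk x k t → s t ≡ nothing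
    walk-accepted (stop e) = e
    walk-accepted (_ ∷ w)  = walk-accepted w

  preimage-just : ∀ {c n} (g : Fin c → Fin n) w {j} → preimage g w ≡ just j → toℕ (g j) ≡ w
  preimage-just {suc c} g w e with toℕ (g fz) ℕ.≟ w
  preimage-just {suc c} g w refl | yes g₀≡w = g₀≡w
  ... | no _ with preimage (g ∘ fs) w in eq
  preimage-just {suc c} g w refl | no _ | just j = preimage-just (g ∘ fs) w eq

  preimage-nothing : ∀ {c n} (g : Fin c → Fin n) w → preimage g w ≡ nothing → ∀ j → toℕ (g j) ≢ w
  preimage-nothing {suc c} g w e j with toℕ (g fz) ℕ.≟ w
  preimage-nothing {suc c} g w () j | yes _
  ... | no g₀≢w with preimage (g ∘ fs) w in eq
  preimage-nothing {suc c} g w refl fz     | no g₀≢w | nothing = g₀≢w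
  preimage-nothing {suc c} g w refl (fs j) | no g₀≢w | nothing = preimage-nothing (g ∘ fs) w eq j

  -- Mr. j has mistress g j and wife L j. Keeping the wives as a separate injection L, instead of
  -- Mr. j ↦ Mrs. j, is what lets Mr. 1 be removed: the remaining men are renumbered, their wives are not.
  next : ∀ {c n} → (Fin c → Fin n) → (Fin c → Fin n) → Fin n → Maybe (Fin n)
  next L g w = Maybe.map L (preimage g (toℕ w))

  next-just : ∀ {c n} {L g : Fin c → Fin n} {w v} → next L g w ≡ just v → ∃ λ j → g j ≡ w × L j ≡ v
  next-just {g = g} {w} e with preimage g (toℕ w) in eq
  next-just {g = g} {w} refl | just j = j , toℕ-injective (preimage-just g (toℕ w) eq) , refl

  next-nothing : ∀ {c n} {L g : Fin c → Fin n} {w} → next L g w ≡ nothing → w ∉img g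
  next-nothing {g = g} {w} e j with preimage g (toℕ w) in eq
  next-nothing {g = g} {w} refl j | nothing = preimage-nothing g (toℕ w) eq j ∘ cong toℕ

  next-hit : ∀ {c n} (L M : Fin (suc c) → Fin n) → next L M (M fz) ≡ just (L fz)
  next-hit L M with toℕ (M fz) ℕ.≟ toℕ (M fz)
  ... | yes _ = refl
  ... | no ≢  = ⊥-elim (≢ refl)

  next-miss : ∀ {c n} (L M : Fin (suc c) → Fin n) {w} → M fz ≢ w → next L M w ≡ next (L ∘ fs) (M ∘ fs) w
  next-miss L M {w} M₀≢w with toℕ (M fz) ℕ.≟ toℕ w
  ... | yes e = ⊥-elim (M₀≢w (toℕ-injective e))
  ... | no _  = sym (MaybeP.map-∘ (preimage (M ∘ fs) (toℕ w)))

  chain≡walkLength : ∀ {c n} (L M : Fin c → Fin n) → (∀ j → toℕ (L j) ≡ toℕ j) →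
                     ∀ fuel w → chain M fuel (toℕ w) ≡ walkLength (next L M) fuel w
  chain≡walkLength L M L≗toℕ zero       w = refl
  chain≡walkLength L M L≗toℕ (suc fuel) w with preimage M (toℕ w)
  ... | nothing = refl
  ... | just j  = cong suc (trans (cong (chain M fuel) (sym (L≗toℕ j))) (chain≡walkLength L M L≗toℕ fuel (L j)))

  unique-map : ∀ {A B : Set} {P : A → Set} (f : A → B) → (∀ {x y} → P x → P y → f x ≡ f y → x ≡ y) →
               ∀ {xs} → All P xs → Unique xs → Unique (map f xs)
  unique-map f inj []         []             = []
  unique-map {P = P} f inj {x ∷ _} (px ∷ pxs) (x∉xs ∷ unique) = distinct pxs x∉xs ∷ unique-map f inj pxs unique
    where
    distinct : ∀ {ys} → All P ys → All (x ≢_) ys → All (f x ≢_) (map f ys)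
    distinct []         []           = []
    distinct (py ∷ pys) (x≢y ∷ x∉ys) = (x≢y ∘ inj px py) ∷ distinct pys x∉ys

  requestsFrom : ∀ {c n} → (Fin c → Fin n) → (Fin c → Fin n) → Fin n → ℕ
  requestsFrom {c} L g = walkLength (next L g) (suc c)

  acceptor : ∀ {c n} → (Fin c → Fin n) → (Fin c → Fin n) → Fin n → Fin n
  acceptor {c} L g = walkEnd (next L g) (suc c)

  record WalkFacts {c n} (L g : Fin c → Fin n) : Set where
    field
      walk               : ∀ {x} → x ∉img L → Walk (next L g) x (requestsFrom L g x) (acceptor L g x)
      acceptor-injective : ∀ {x y} → x ∉img L → y ∉img L → acceptor L g x ≡ acceptor L g y → x ≡ y
      -- Walks from distinct starts never meet, so they ask each wife at most once between them;
      -- in particular the fuel suc c of `chain` suffices.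
      total-requests-bound : ∀ {S} → Unique S → All (_∉img L) S → ∑ (requestsFrom L g) S ≤ c + length S

    ∑-δ-acceptor≤1 : ∀ {S} → Unique S → All (_∉img L) S → ∀ b → ∑ (λ x → δ b (acceptor L g x)) S ≤ 1
    ∑-δ-acceptor≤1 {S} unique S∉L b = ℕP.≤-trans (ℕP.≤-reflexive (sym (∑-map (δ b) (acceptor L g) S)))
                                                (∑-δ-unique b (unique-map (acceptor L g) acceptor-injective S∉L unique))

  -- Mr. 1 (index fz), with mistress a and wife w₀, joins the men 2, …, c+1: the walk accepted by a now
  -- continues with the walk from w₀, and every other walk is unchanged.
  module Extension {c n} {L M : Fin (suc c) → Fin n} (injL : Injective _≡_ _≡_ L) (injM : Injective _≡_ _≡_ M)
                   (ih : WalkFacts (L ∘ fs) (M ∘ fs)) where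

    open WalkFacts ih renaming (walk to walk′; acceptor-injective to acceptor′-injective;
                                total-requests-bound to total-requests-bound′)

    private
      a w₀ : Fin n
      a  = M fz
      w₀ = L fz
      g L′ : Fin c → Fin n
      g  = M ∘ fs
      L′ = L ∘ fs
      requests′ : Fin n → ℕ
      requests′ = requestsFrom L′ g
      acceptor′ : Fin n → Fin n
      acceptor′ = acceptor L′ g

      fs≢fz : ∀ {j : Fin c} → fs j ≢ fz
      fs≢fz ()

      a∉g : a ∉img g
      a∉g j e = fs≢fz (injM e)

      w₀∉L′ : w₀ ∉img L′
      w₀∉L′ j e = fs≢fz (injL e)

    lift-step : ∀ {x y} → next L′ g x ≡ just y → next L M x ≡ just y
    lift-step {x} e with next-just e
    ... | j , gj≡x , _ = trans (next-miss L M (λ a≡x → a∉g j (trans gj≡x (sym a≡x)))) e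

    lift : ∀ {x k t} → Walk (next L′ g) x k t → a ≢ t → Walk (next L M) x k t
    lift (stop e) a≢t = stop (trans (next-miss L M a≢t) e)
    lift (e ∷ w)  a≢t = lift-step e ∷ lift w a≢t

    join : ∀ {x k k′ t} → Walk (next L′ g) x k a → Walk (next L′ g) w₀ k′ t → a ≢ t →
           Walk (next L M) x (k + k′) t
    join (stop _) w₀⇝t a≢t = next-hit L M ∷ lift w₀⇝t a≢t
    join (e ∷ w)  w₀⇝t a≢t = lift-step e ∷ join w w₀⇝t a≢t

    module _ {x} (x∉L : x ∉img L) where

      private
        x∉L′ : x ∉img L′
        x∉L′ = x∉L ∘ fs

        w₀≢x : w₀ ≢ x
        w₀≢x = x∉L fz

        bound : requests′ x + requests′ w₀ ≤ suc (suc c)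
        bound = ℕP.≤-trans (ℕP.≤-reflexive (cong (requests′ x +_) (sym (ℕP.+-identityʳ (requests′ w₀)))))
                  (ℕP.≤-trans (total-requests-bound′ ((w₀≢x ∘ sym ∷ []) ∷ [] ∷ []) (x∉L′ ∷ w₀∉L′ ∷ []))
                              (ℕP.≤-reflexive (ℕP.+-comm c 2)))

      walk-hit : a ≡ acceptor′ x → Walk (next L M) x (requests′ x + requests′ w₀) (acceptor′ w₀)
      walk-hit a≡t = join (subst (Walk _ x _) (sym a≡t) (walk′ x∉L′)) (walk′ w₀∉L′)
                          (λ a≡t₀ → w₀≢x (acceptor′-injective w₀∉L′ x∉L′ (trans (sym a≡t₀) a≡t)))

      walk-miss : a ≢ acceptor′ x → Walk (next L M) x (requests′ x) (acceptor′ x)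
      walk-miss = lift (walk′ x∉L′)

      requests-hit : a ≡ acceptor′ x → requestsFrom L M x ≡ requests′ x + requests′ w₀
      requests-hit a≡t = walk⇒walkLength _ (walk-hit a≡t) bound

      acceptor-hit : a ≡ acceptor′ x → acceptor L M x ≡ acceptor′ w₀
      acceptor-hit a≡t = walk⇒walkEnd _ (walk-hit a≡t) bound

      requests-miss : a ≢ acceptor′ x → requestsFrom L M x ≡ requests′ x
      requests-miss a≢t = walk⇒walkLength _ (walk-miss a≢t) (ℕP.≤-trans (ℕP.m≤m+n _ _) bound)

      acceptor-miss : a ≢ acceptor′ x → acceptor L M x ≡ acceptor′ x
      acceptor-miss a≢t = walk⇒walkEnd _ (walk-miss a≢t) (ℕP.≤-trans (ℕP.m≤m+n _ _) bound)

      requests-extend : requestsFrom L M x ≡ requests′ x + requests′ w₀ * δ a (acceptor′ x)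
      requests-extend with a ≟ acceptor′ x
      ... | yes a≡t = trans (requests-hit a≡t) (cong (requests′ x +_) (sym (ℕP.*-identityʳ (requests′ w₀))))
      ... | no  a≢t = trans (requests-miss a≢t)
                        (sym (trans (cong (requests′ x +_) (ℕP.*-zeroʳ (requests′ w₀))) (ℕP.+-identityʳ (requests′ x))))

    extend : WalkFacts L M
    extend = record { walk = walk ; acceptor-injective = acceptor-injective ; total-requests-bound = total-requests-bound }
      where
      walk : ∀ {x} → x ∉img L → Walk (next L M) x (requestsFrom L M x) (acceptor L M x)
      walk {x} x∉L with a ≟ acceptor′ x
      ... | yes a≡t = subst₂ (Walk _ x) (sym (requests-hit x∉L a≡t)) (sym (acceptor-hit x∉L a≡t)) (walk-hit x∉L a≡t)
      ... | no  a≢t = subst₂ (Walk _ x) (sym (requests-miss x∉L a≢t)) (sym (acceptor-miss x∉L a≢t)) (walk-miss x∉L a≢t)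

      acceptor-injective : ∀ {x y} → x ∉img L → y ∉img L → acceptor L M x ≡ acceptor L M y → x ≡ y
      acceptor-injective {x} {y} x∉L y∉L e with a ≟ acceptor′ x | a ≟ acceptor′ y
      ... | yes ax | yes ay = acceptor′-injective (x∉L ∘ fs) (y∉L ∘ fs) (trans (sym ax) ay)
      ... | yes ax | no  ay = ⊥-elim (y∉L fz (acceptor′-injective w₀∉L′ (y∉L ∘ fs)
                                (trans (sym (acceptor-hit x∉L ax)) (trans e (acceptor-miss y∉L ay)))))
      ... | no  ax | yes ay = ⊥-elim (x∉L fz (acceptor′-injective w₀∉L′ (x∉L ∘ fs)
                                (trans (sym (acceptor-hit y∉L ay)) (trans (sym e) (acceptor-miss x∉L ax)))))
      ... | no  ax | no  ay = acceptor′-injective (x∉L ∘ fs) (y∉L ∘ fs)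
                                (trans (sym (acceptor-miss x∉L ax)) (trans e (acceptor-miss y∉L ay)))

      total-requests-bound : ∀ {S} → Unique S → All (_∉img L) S → ∑ (requestsFrom L M) S ≤ suc c + length S
      total-requests-bound {S} unique S∉L = begin
        ∑ (requestsFrom L M) S
          ≡⟨ ∑-cong-All (All.map requests-extend S∉L) ⟩
        ∑ (λ x → requests′ x + requests′ w₀ * δ a (acceptor′ x)) S
          ≡⟨ trans (∑-+ requests′ _ S) (cong (∑ requests′ S +_) (∑-*ˡ (requests′ w₀) _ S)) ⟩
        ∑ requests′ S + requests′ w₀ * ∑ (λ x → δ a (acceptor′ x)) S
          ≤⟨ ℕP.+-monoʳ-≤ (∑ requests′ S) (ℕP.*-monoʳ-≤ (requests′ w₀) (∑-δ-acceptor≤1 unique S∉L′ a)) ⟩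
        ∑ requests′ S + requests′ w₀ * 1
          ≡⟨ trans (cong (∑ requests′ S +_) (ℕP.*-identityʳ (requests′ w₀)))
                   (ℕP.+-comm (∑ requests′ S) (requests′ w₀)) ⟩
        ∑ requests′ (w₀ ∷ S)
          ≤⟨ total-requests-bound′ (All.map (λ x∉L → x∉L fz) S∉L ∷ unique) (w₀∉L′ ∷ S∉L′) ⟩
        c + suc (length S)
          ≡⟨ ℕP.+-suc c (length S) ⟩
        suc c + length S ∎
        where
        open ℕP.≤-Reasoning
        S∉L′ : All (_∉img L′) S
        S∉L′ = All.map (_∘ fs) S∉L

  walkFacts : ∀ {c n} {L g : Fin c → Fin n} → Injective _≡_ _≡_ L → Injective _≡_ _≡_ g → WalkFacts L g
  walkFacts {zero} _ _ = record
    { walk                 = λ _ → stop refl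
    ; acceptor-injective   = λ _ _ e → e
    ; total-requests-bound = λ {S} _ _ → ℕP.≤-reflexive (∑-const-1 S)
    }
  walkFacts {suc c} injL injg = Extension.extend injL injg (walkFacts (fs-injective ∘ injL) (fs-injective ∘ injg))

  infixr 8 _↑_

  _↑_ : ℕ → ℕ → ℕ
  x ↑ zero  = 1
  x ↑ suc j = x * (suc x ↑ j)

  ↑-suc : ∀ x j → x ↑ suc j ≡ x ↑ j * (x + j)
  ↑-suc x zero    = trans (ℕP.*-identityʳ x) (sym (trans (ℕP.*-identityˡ (x + 0)) (ℕP.+-identityʳ x)))
  ↑-suc x (suc j) = begin
    x * (suc x ↑ suc j)            ≡⟨ cong (x *_) (↑-suc (suc x) j) ⟩
    x * (suc x ↑ j * (suc x + j))  ≡⟨ ℕP.*-assoc x _ _ ⟨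
    x ↑ suc j * (suc x + j)        ≡⟨ cong (x ↑ suc j *_) (ℕP.+-suc x j) ⟨
    x ↑ suc j * (x + suc j)        ∎
    where open ≡-Reasoning

  ↑-+ : ∀ x a b → x ↑ (a + b) ≡ x ↑ a * (a + x) ↑ b
  ↑-+ x zero    b = sym (ℕP.*-identityˡ (x ↑ b))
  ↑-+ x (suc a) b = begin
    x * suc x ↑ (a + b)                ≡⟨ cong (x *_) (↑-+ (suc x) a b) ⟩
    x * (suc x ↑ a * (a + suc x) ↑ b)  ≡⟨ ℕP.*-assoc x _ _ ⟨
    x ↑ suc a * (a + suc x) ↑ b        ≡⟨ cong (λ y → x ↑ suc a * y ↑ b) (ℕP.+-suc a x) ⟩
    x ↑ suc a * (suc a + x) ↑ b        ∎
    where open ≡-Reasoning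

  suc-↑ : ∀ x j → ∃ λ p → suc x ↑ j ≡ suc p
  suc-↑ x zero    = 0 , refl
  suc-↑ x (suc j) with suc-↑ (suc x) j
  ... | p , e = p + x * suc p , cong (suc x *_) e

  ∑-indicator : ∀ {A : Set} (w h : A → ℕ) (φ : ℕ → ℕ) X Y xs → (∀ a → h a ≤ 1) →
    ∑ (λ a → w a * φ (X + Y * h a)) xs + ∑ (λ a → w a * h a) xs * φ X
      ≡ ∑ w xs * φ X + ∑ (λ a → w a * h a) xs * φ (X + Y)
  ∑-indicator w h φ X Y xs h≤1 = begin
    ∑ (λ a → w a * φ (X + Y * h a)) xs + ∑ (λ a → w a * h a) xs * φ X
      ≡⟨ cong (∑ (λ a → w a * φ (X + Y * h a)) xs +_) (∑-*ʳ (φ X) (λ a → w a * h a) xs) ⟨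
    ∑ (λ a → w a * φ (X + Y * h a)) xs + ∑ (λ a → w a * h a * φ X) xs
      ≡⟨ ∑-+ _ _ xs ⟨
    ∑ (λ a → w a * φ (X + Y * h a) + w a * h a * φ X) xs
      ≡⟨ ∑-cong (λ a → pointwise (w a) (h a) (h≤1 a)) xs ⟩
    ∑ (λ a → w a * φ X + w a * h a * φ (X + Y)) xs
      ≡⟨ ∑-+ _ _ xs ⟩
    ∑ (λ a → w a * φ X) xs + ∑ (λ a → w a * h a * φ (X + Y)) xs
      ≡⟨ cong₂ _+_ (∑-*ʳ (φ X) w xs) (∑-*ʳ (φ (X + Y)) (λ a → w a * h a) xs) ⟩
    ∑ w xs * φ X + ∑ (λ a → w a * h a) xs * φ (X + Y) ∎
    where
    open ≡-Reasoning
    pointwise : ∀ v k → k ≤ 1 → v * φ (X + Y * k) + v * k * φ X ≡ v * φ X + v * k * φ (X + Y)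
    pointwise v 0 _ rewrite ℕP.*-zeroʳ Y | ℕP.+-identityʳ X | ℕP.*-zeroʳ v = refl
    pointwise v 1 _ rewrite ℕP.*-identityʳ Y | ℕP.*-identityʳ v = ℕP.+-comm (v * φ (X + Y)) (v * φ X)
    pointwise v (suc (suc _)) (s≤s ())

  totalRequests : ∀ {c n} → (Fin c → Fin n) → (Fin c → Fin n) → List (Fin n) → ℕ
  totalRequests L g = ∑ (requestsFrom L g)

  -- Of the m+1 women outside the image of g, exactly the |S| acceptors of walks from S make the
  -- walk from w₀ = L fz part of the total when chosen as the mistress of Mr. 1.
  ∑-over-new-mistress : ∀ {c m n} → c + suc m ≡ n → ∀ j {L : Fin (suc c) → Fin n} → Injective _≡_ _≡_ L →
    ∀ {S} → Unique S → All (_∉img L) S → ∀ {g : Fin c → Fin n} → Injective _≡_ _≡_ g →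
    ∑ (λ a → χ ⌊ a ∉img? g ⌋ * totalRequests L (cons a g) S ↑ j) (allFin n)
      + length S * totalRequests (L ∘ fs) g S ↑ j
      ≡ suc m * totalRequests (L ∘ fs) g S ↑ j + length S * totalRequests (L ∘ fs) g (L fz ∷ S) ↑ j
  ∑-over-new-mistress {c} {m} {n} c+sm≡n j {L} injL {S} unique S∉L {g} injg = begin
    ∑ (λ a → w a * totalRequests L (cons a g) S ↑ j) (allFin n) + k * T′ ↑ j
      ≡⟨ cong₂ _+_ (∑-cong T-extend (allFin n)) (cong (_* T′ ↑ j) (sym ∑w*hits)) ⟩
    ∑ (λ a → w a * (T′ + ℓ₀ * hits a) ↑ j) (allFin n) + ∑ (λ a → w a * hits a) (allFin n) * T′ ↑ j
      ≡⟨ ∑-indicator w hits (_↑ j) T′ ℓ₀ (allFin n) (∑-δ-acceptor≤1 unique S∉L′) ⟩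
    ∑ w (allFin n) * T′ ↑ j + ∑ (λ a → w a * hits a) (allFin n) * (T′ + ℓ₀) ↑ j
      ≡⟨ cong₂ _+_ (cong (_* T′ ↑ j) ∑w) (cong₂ _*_ ∑w*hits (cong (_↑ j) (ℕP.+-comm T′ ℓ₀))) ⟩
    suc m * T′ ↑ j + k * totalRequests L′ g (w₀ ∷ S) ↑ j ∎
    where
    open ≡-Reasoning
    k : ℕ
    k = length S
    L′ : Fin c → Fin n
    L′ = L ∘ fs
    w₀ : Fin n
    w₀ = L fz
    facts : WalkFacts L′ g
    facts = walkFacts (fs-injective ∘ injL) injg
    open WalkFacts facts
    S∉L′ : All (_∉img L′) S
    S∉L′ = All.map (_∘ fs) S∉L

    w hits : Fin n → ℕ
    w a    = χ ⌊ a ∉img? g ⌋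
    hits a = ∑ (λ x → δ a (acceptor L′ g x)) S

    T′ ℓ₀ : ℕ
    T′ = totalRequests L′ g S
    ℓ₀ = requestsFrom L′ g w₀

    T-extend : ∀ a → w a * totalRequests L (cons a g) S ↑ j ≡ w a * (T′ + ℓ₀ * hits a) ↑ j
    T-extend a with a ∉img? g
    ... | no _    = refl
    ... | yes a∉g = cong (λ t → 1 * t ↑ j) (begin
      totalRequests L (cons a g) S
        ≡⟨ ∑-cong-All (All.map (Extension.requests-extend injL injM facts) S∉L) ⟩
      ∑ (λ x → requestsFrom L′ g x + ℓ₀ * δ a (acceptor L′ g x)) S
        ≡⟨ trans (∑-+ (requestsFrom L′ g) _ S) (cong (T′ +_) (∑-*ˡ ℓ₀ _ S)) ⟩
      T′ + ℓ₀ * hits a ∎)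
      where
      injM : Injective _≡_ _≡_ (cons a g)
      injM = Equivalence.from (cons-injective a g) (injg , a∉g)

    ∑w : ∑ w (allFin n) ≡ suc m
    ∑w = ℕP.+-cancelʳ-≡ c _ _ (trans (∑-χ-∉img g injg) (trans (sym c+sm≡n) (ℕP.+-comm c (suc m))))

    ∑w*hits : ∑ (λ a → w a * hits a) (allFin n) ≡ k
    ∑w*hits = begin
      ∑ (λ a → w a * hits a) (allFin n)                             ≡⟨ ∑-cong (λ a → ∑-*ˡ (w a) _ S) (allFin n) ⟨
      ∑ (λ a → ∑ (λ x → w a * δ a (acceptor L′ g x)) S) (allFin n)  ≡⟨ ∑-swap _ (allFin n) S ⟩
      ∑ (λ x → ∑ (λ a → w a * δ a (acceptor L′ g x)) (allFin n)) S  ≡⟨ ∑-cong (λ x → ∑-δ w (acceptor L′ g x)) S ⟩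
      ∑ (λ x → w (acceptor L′ g x)) S                               ≡⟨ ∑-cong-All (All.map acceptor∉g S∉L′) ⟩
      ∑ (λ _ → 1) S                                                 ≡⟨ ∑-const-1 S ⟩
      k                                                             ∎
      where
      acceptor∉g : ∀ {x} → x ∉img L′ → w (acceptor L′ g x) ≡ 1
      acceptor∉g x∉L′ = χ-yes (_ ∉img? g) (next-nothing (walk-accepted _ (walk x∉L′)))

  ∑-rising-totalRequests : ∀ c m {n} → c + m ≡ n → ∀ j {L : Fin c → Fin n} → Injective _≡_ _≡_ L →
    ∀ {S} → Unique S → All (_∉img L) S →
    ∑ (λ g → totalRequests L g S ↑ j) (injections c n) ≡ length S ↑ j * (m + suc j) ↑ c
  ∑-rising-totalRequests zero m refl j {L} _ {S} _ _ = begin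
    totalRequests L (λ ()) S ↑ j + 0  ≡⟨ ℕP.+-identityʳ _ ⟩
    totalRequests L (λ ()) S ↑ j      ≡⟨ cong (_↑ j) (∑-const-1 S) ⟩
    length S ↑ j                      ≡⟨ ℕP.*-identityʳ _ ⟨
    length S ↑ j * 1                  ∎
    where open ≡-Reasoning
  ∑-rising-totalRequests (suc c) m {n} c+m≡n j {L} injL {S} unique S∉L = ℕP.+-cancelʳ-≡ (k * A) _ _ (begin
    ∑ (λ M → totalRequests L M S ↑ j) (injections (suc c) n) + k * A
      ≡⟨ cong₂ _+_ (∑-injections-suc c n (λ M → totalRequests L M S ↑ j)) (sym (∑-*ˡ k _ (injections c n))) ⟩
    ∑ (λ g → ∑ (λ a → χ ⌊ a ∉img? g ⌋ * totalRequests L (cons a g) S ↑ j) (allFin n)) (injections c n)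
      + ∑ (λ g → k * totalRequests L′ g S ↑ j) (injections c n)
      ≡⟨ trans (sym (∑-+ _ _ (injections c n)))
               (∑-cong-All (All.map (∑-over-new-mistress c+sm≡n j injL unique S∉L) (injections-injective c n))) ⟩
    ∑ (λ g → suc m * totalRequests L′ g S ↑ j + k * totalRequests L′ g (w₀ ∷ S) ↑ j) (injections c n)
      ≡⟨ trans (∑-+ _ _ (injections c n)) (cong₂ _+_ (∑-*ˡ (suc m) _ (injections c n)) (∑-*ˡ k _ (injections c n))) ⟩
    suc m * A + k * B
      ≡⟨ cong₂ (λ u v → suc m * u + k * v) IH-A IH-B ⟩
    suc m * (k ↑ j * P) + k * (suc k ↑ j * P)
      ≡⟨ cong (suc m * (k ↑ j * P) +_) (trans (sym (ℕP.*-assoc k _ P)) (cong (_* P) (↑-suc k j))) ⟩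
    suc m * (k ↑ j * P) + k ↑ j * (k + j) * P
      ≡⟨ arithmetic (k ↑ j) m j k P ⟨
    k ↑ j * ((m + suc j) * P) + k * (k ↑ j * P)
      ≡⟨ cong (λ u → k ↑ j * ((m + suc j) * P) + k * u) IH-A ⟨
    k ↑ j * (m + suc j) ↑ suc c + k * A ∎)
    where
    open ≡-Reasoning
    k : ℕ
    k = length S
    L′ : Fin c → Fin n
    L′ = L ∘ fs
    w₀ : Fin n
    w₀ = L fz
    injL′ : Injective _≡_ _≡_ L′
    injL′ = fs-injective ∘ injL
    S∉L′ : All (_∉img L′) S
    S∉L′ = All.map (_∘ fs) S∉L
    w₀∉L′ : w₀ ∉img L′
    w₀∉L′ j e with injL e
    ... | ()
    c+sm≡n : c + suc m ≡ n
    c+sm≡n = trans (ℕP.+-suc c m) c+m≡n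
    P A B : ℕ
    P = (suc m + suc j) ↑ c
    A = ∑ (λ g → totalRequests L′ g S ↑ j) (injections c n)
    B = ∑ (λ g → totalRequests L′ g (w₀ ∷ S) ↑ j) (injections c n)
    IH-A : A ≡ k ↑ j * P
    IH-A = ∑-rising-totalRequests c (suc m) c+sm≡n j injL′ unique S∉L′
    IH-B : B ≡ suc k ↑ j * P
    IH-B = ∑-rising-totalRequests c (suc m) c+sm≡n j injL′
             (All.map (λ x∉L → x∉L fz) S∉L ∷ unique) (w₀∉L′ ∷ S∉L′)
    arithmetic : ∀ r m j k P → r * ((m + suc j) * P) + k * (r * P) ≡ suc m * (r * P) + r * (k + j) * P
    arithmetic = solve-∀

  module _ (c f : ℕ) (1≤f : 1 ≤ f) where

    private
      wife : Fin c → Fin (c + f)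
      wife i = i ↑ˡ f

      mrs-c+1 : Fin (c + f)
      mrs-c+1 = fromℕ< (ℕP.m<m+n c 1≤f)

      wife-injective : Injective _≡_ _≡_ wife
      wife-injective e = toℕ-injective (trans (sym (toℕ-↑ˡ _ f)) (trans (cong toℕ e) (toℕ-↑ˡ _ f)))

      mrs-c+1∉wives : mrs-c+1 ∉img wife
      mrs-c+1∉wives i e = ℕP.<-irrefl (trans (sym (toℕ-↑ˡ i f)) (trans (cong toℕ e) (toℕ-fromℕ< _))) (toℕ<n i)

      requests≡totalRequests : ∀ M → requests M c ≡ totalRequests wife M (mrs-c+1 ∷ [])
      requests≡totalRequests M = begin
        chain M (suc c) c                          ≡⟨ cong (chain M (suc c)) (toℕ-fromℕ< _) ⟨
        chain M (suc c) (toℕ mrs-c+1)              ≡⟨ chain≡walkLength wife M (λ i → toℕ-↑ˡ i f) (suc c) mrs-c+1 ⟩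
        requestsFrom wife M mrs-c+1                ≡⟨ ℕP.+-identityʳ _ ⟨
        totalRequests wife M (mrs-c+1 ∷ [])        ∎
        where open ≡-Reasoning

    ∑-rising-requests : ∀ j → ∑ (λ M → requests M c ↑ j) (injections c (c + f)) ≡ 1 ↑ j * (f + suc j) ↑ c
    ∑-rising-requests j =
      trans (∑-cong (λ M → cong (_↑ j) (requests≡totalRequests M)) (injections c (c + f)))
            (∑-rising-totalRequests c f refl j wife-injective ([] ∷ []) (mrs-c+1∉wives ∷ []))

    injections-count : length (injections c (c + f)) ≡ suc f ↑ c
    injections-count = begin
      length (injections c (c + f))                      ≡⟨ ∑-const-1 (injections c (c + f)) ⟨
      ∑ (λ M → requests M c ↑ 0) (injections c (c + f))  ≡⟨ ∑-rising-requests 0 ⟩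
      1 * (f + 1) ↑ c                                    ≡⟨ trans (ℕP.*-identityˡ _) (cong (_↑ c) (ℕP.+-comm f 1)) ⟩
      suc f ↑ c                                          ∎
      where open ≡-Reasoning

    injections-nonempty : ∃ λ p → length (injections c (c + f)) ≡ suc p
    injections-nonempty = let (p , e) = suc-↑ f c in p , trans injections-count e

    rising-moment : ∀ j → ∑ (λ M → requests M c ↑ j) (injections c (c + f)) * suc f ↑ j
                        ≡ 1 ↑ j * length (injections c (c + f)) * (c + f + 1) ↑ j
    rising-moment j = begin
      ∑ (λ M → requests M c ↑ j) (injections c (c + f)) * suc f ↑ j
        ≡⟨ cong (_* suc f ↑ j) (∑-rising-requests j) ⟩
      1 ↑ j * (f + suc j) ↑ c * suc f ↑ j
        ≡⟨ trans (ℕP.*-assoc (1 ↑ j) _ _) (trans (cong (1 ↑ j *_) exchange) (sym (ℕP.*-assoc (1 ↑ j) _ _))) ⟩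
      1 ↑ j * suc f ↑ c * (c + f + 1) ↑ j
        ≡⟨ cong (λ N → 1 ↑ j * N * (c + f + 1) ↑ j) injections-count ⟨
      1 ↑ j * length (injections c (c + f)) * (c + f + 1) ↑ j ∎
      where
      open ≡-Reasoning
      exchange : (f + suc j) ↑ c * suc f ↑ j ≡ suc f ↑ c * (c + f + 1) ↑ j
      exchange = begin
        (f + suc j) ↑ c * suc f ↑ j  ≡⟨ ℕP.*-comm _ (suc f ↑ j) ⟩
        suc f ↑ j * (f + suc j) ↑ c  ≡⟨ cong (λ y → suc f ↑ j * y ↑ c) (trans (ℕP.+-suc j f) (ℕP.+-comm (suc j) f)) ⟨
        suc f ↑ j * (j + suc f) ↑ c  ≡⟨ ↑-+ (suc f) j c ⟨
        suc f ↑ (j + c)              ≡⟨ cong (suc f ↑_) (ℕP.+-comm j c) ⟩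
        suc f ↑ (c + j)              ≡⟨ ↑-+ (suc f) c j ⟩
        suc f ↑ c * (c + suc f) ↑ j  ≡⟨ cong (λ y → suc f ↑ c * y ↑ j) (trans (ℕP.+-suc c f) (ℕP.+-comm 1 (c + f))) ⟩
        suc f ↑ c * (c + f + 1) ↑ j  ∎

module IntegerMoments where

  open Counting using (_↑_; ↑-suc; ∑; ∑-const-1; rising-moment)
  open import Data.Integer using (ℤ; +_; -_; _+_; _-_; _*_)
  import Data.Integer.Properties as ℤP
  open import Data.Integer.Tactic.RingSolver using (solve-∀; ring)
  import Data.Nat as ℕ
  import Data.Nat.Properties as ℕP
  open import Tactic.RingSolver.Core.AlmostCommutativeRing using (AlmostCommutativeRing)
  open AlmostCommutativeRing ring using (_^_)
  open ListSum ℤP.+-*-commutativeSemiring using ()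
    renaming (∑ to ∑ℤ; ∑-zero to ∑ℤ-zero; ∑-cong to ∑ℤ-cong; ∑-+ to ∑ℤ-+; ∑-*ˡ to ∑ℤ-*ˡ)

  infixr 8 _↑ℤ_

  _↑ℤ_ : ℤ → ℕ → ℤ
  x ↑ℤ zero        = + 1
  x ↑ℤ suc zero    = x
  x ↑ℤ suc (suc j) = x ↑ℤ suc j * (x + + suc j)

  +-↑ : ∀ x j → + (x ↑ j) ≡ (+ x) ↑ℤ j
  +-↑ x zero          = refl
  +-↑ x (suc zero)    = cong +_ (ℕP.*-identityʳ x)
  +-↑ x (suc (suc j)) = begin
    + (x ↑ suc (suc j))                   ≡⟨ cong +_ (↑-suc x (suc j)) ⟩
    + (x ↑ suc j ℕ.* (x ℕ.+ suc j))       ≡⟨ ℤP.pos-* (x ↑ suc j) (x ℕ.+ suc j) ⟩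
    + (x ↑ suc j) * + (x ℕ.+ suc j)       ≡⟨ cong (_* + (x ℕ.+ suc j)) (+-↑ x (suc j)) ⟩
    (+ x) ↑ℤ suc j * (+ x + + suc j)      ∎
    where open ≡-Reasoning

  ∑ℤ-pos : ∀ {A : Set} (h : A → ℕ) xs → ∑ℤ (λ x → + h x) xs ≡ + ∑ h xs
  ∑ℤ-pos h []       = refl
  ∑ℤ-pos h (x ∷ xs) = trans (cong (λ s → + h x + s) (∑ℤ-pos h xs)) (sym (ℤP.pos-+ (h x) (∑ h xs)))

  combination : List ℤ → (ℕ → ℤ) → ℤ
  combination []           v = + 0
  combination (a ∷ [])     v = a * v 0
  combination (a ∷ b ∷ as) v = a * v (suc (length as)) + combination (b ∷ as) v

  ∑ℤ-combination : ∀ {A : Set} as (r : ℕ → A → ℤ) xs →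
                   ∑ℤ (λ x → combination as (λ i → r i x)) xs ≡ combination as (λ i → ∑ℤ (r i) xs)
  ∑ℤ-combination []           r xs = ∑ℤ-zero xs
  ∑ℤ-combination (a ∷ [])     r xs = ∑ℤ-*ˡ a (r 0) xs
  ∑ℤ-combination (a ∷ b ∷ as) r xs =
    trans (∑ℤ-+ _ _ xs) (cong₂ _+_ (∑ℤ-*ˡ a (r (suc (length as))) xs) (∑ℤ-combination (b ∷ as) r xs))

  combination-vanishes : ∀ as {v} → (∀ i → v i ≡ + 0) → combination as v ≡ + 0
  combination-vanishes []           v≡0 = refl
  combination-vanishes (a ∷ [])     v≡0 = trans (cong (a *_) (v≡0 0)) (ℤP.*-zeroʳ a)
  combination-vanishes (a ∷ b ∷ as) v≡0 =
    cong₂ _+_ (trans (cong (a *_) (v≡0 _)) (ℤP.*-zeroʳ a)) (combination-vanishes (b ∷ as) v≡0)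

  +-vanishingʳ : ∀ {x y} → y ≡ + 0 → x + y ≡ x
  +-vanishingʳ {x} refl = ℤP.+-identityʳ x

  cube-coefficients : ℤ → ℤ → List ℤ
  cube-coefficients d K = d ^ 3 ∷ - (+ 3 * d ^ 2 * (d + K)) ∷ d * (d ^ 2 + + 3 * d * K + + 3 * K ^ 2) ∷ - K ^ 3 ∷ []

  cube-in-rising-basis : ∀ d K x → (d * x - K) ^ 3 ≡ combination (cube-coefficients d K) (x ↑ℤ_)
  cube-in-rising-basis = expansion
    where
    expansion : ∀ d K x → (d * x - K) ^ 3 ≡
        d ^ 3 * (x * (x + + 1) * (x + + 2))
      + (- (+ 3 * d ^ 2 * (d + K)) * (x * (x + + 1))
      + (d * (d ^ 2 + + 3 * d * K + + 3 * K ^ 2) * x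
      + - K ^ 3 * + 1))
    expansion = solve-∀

  fourth-power-coefficients : ℤ → ℤ → List ℤ
  fourth-power-coefficients d K =
    d ^ 4 ∷ - (+ 2 * d ^ 3 * (+ 3 * d + + 2 * K)) ∷ d ^ 2 * (+ 7 * d ^ 2 + + 12 * d * K + + 6 * K ^ 2)
      ∷ - (d * (d ^ 3 + + 4 * d ^ 2 * K + + 6 * d * K ^ 2 + + 4 * K ^ 3)) ∷ K ^ 4 ∷ []

  fourth-power-in-rising-basis : ∀ d K x → (d * x - K) ^ 4 ≡ combination (fourth-power-coefficients d K) (x ↑ℤ_)
  fourth-power-in-rising-basis = expansion
    where
    expansion : ∀ d K x → (d * x - K) ^ 4 ≡
        d ^ 4 * (x * (x + + 1) * (x + + 2) * (x + + 3))
      + (- (+ 2 * d ^ 3 * (+ 3 * d + + 2 * K)) * (x * (x + + 1) * (x + + 2))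
      + (d ^ 2 * (+ 7 * d ^ 2 + + 12 * d * K + + 6 * K ^ 2) * (x * (x + + 1))
      + (- (d * (d ^ 3 + + 4 * d ^ 2 * K + + 6 * d * K ^ 2 + + 4 * K ^ 3)) * x
      + K ^ 4 * + 1)))
    expansion = solve-∀

  -- The two sides differ by a combination of the hypotheses with polynomial coefficients,
  -- which `certificate` exhibits.
  cube-moment-identity : ∀ c f (m : ℕ → ℤ) → let d = + 1 + f ; K = c + f + + 1 in
    (∀ j → m j * d ↑ℤ j ≡ (+ 1) ↑ℤ j * m 0 * K ↑ℤ j) →
    combination (cube-coefficients d K) m * ((+ 1 + d) * (+ 2 + d))
      ≡ m 0 * ((c + f + + 1) * c * f * (+ 2 * c * f + f * f - + 2 * c - + 1))
  cube-moment-identity c f m hyp = trans (certificate c f (m 0) (m 1) (m 2) (m 3))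
    (+-vanishingʳ (combination-vanishes
      (d ^ 2 ∷ - (+ 3 * d * (d + K) * (d + + 2)) ∷ (d ^ 2 + + 3 * d * K + + 3 * K ^ 2) * (d + + 1) * (d + + 2) ∷ [])
      (λ i → ℤP.i≡j⇒i-j≡0 (hyp (suc i)))))
    where
    d K : ℤ
    d = + 1 + f
    K = c + f + + 1
    certificate : ∀ c f m₀ m₁ m₂ m₃ → let d = + 1 + f ; K = c + f + + 1 in
      (d ^ 3 * m₃ + (- (+ 3 * d ^ 2 * (d + K)) * m₂ + (d * (d ^ 2 + + 3 * d * K + + 3 * K ^ 2) * m₁ + - K ^ 3 * m₀)))
        * ((+ 1 + d) * (+ 2 + d))
      ≡ m₀ * ((c + f + + 1) * c * f * (+ 2 * c * f + f * f - + 2 * c - + 1))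
        + (d ^ 2 * (m₃ * (d * (d + + 1) * (d + + 2)) - + 6 * m₀ * (K * (K + + 1) * (K + + 2)))
        + (- (+ 3 * d * (d + K) * (d + + 2)) * (m₂ * (d * (d + + 1)) - + 2 * m₀ * (K * (K + + 1)))
        + (d ^ 2 + + 3 * d * K + + 3 * K ^ 2) * (d + + 1) * (d + + 2) * (m₁ * d - + 1 * m₀ * K)))
    certificate = solve-∀

  fourth-power-moment-identity : ∀ c f (m : ℕ → ℤ) → let d = + 1 + f ; K = c + f + + 1 in
    (∀ j → m j * d ↑ℤ j ≡ (+ 1) ↑ℤ j * m 0 * K ↑ℤ j) →
    combination (fourth-power-coefficients d K) m * ((+ 1 + d) * (+ 2 + d) * (+ 3 + d))
      ≡ m 0 * ((c + f + + 1) * c * f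
               * (+ 9 * c * c * f * f + + 9 * c * f * f * f + f * f * f * f - + 3 * c * c * f + + 6 * c * f * f
                  - + 3 * f * f * f + + 6 * c * c + + 3 * c * f - + 9 * f * f + + 6 * c - + 5 * f))
  fourth-power-moment-identity c f m hyp = trans (certificate c f (m 0) (m 1) (m 2) (m 3) (m 4))
    (+-vanishingʳ (combination-vanishes
      (d ^ 3 ∷ - (+ 2 * d ^ 2 * (+ 3 * d + + 2 * K) * (d + + 3)) ∷ d * (+ 7 * d ^ 2 + + 12 * d * K + + 6 * K ^ 2) * (d + + 2) * (d + + 3)
        ∷ - ((d ^ 3 + + 4 * d ^ 2 * K + + 6 * d * K ^ 2 + + 4 * K ^ 3) * (d + + 1) * (d + + 2) * (d + + 3)) ∷ [])
      (λ i → ℤP.i≡j⇒i-j≡0 (hyp (suc i)))))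
    where
    d K : ℤ
    d = + 1 + f
    K = c + f + + 1
    certificate : ∀ c f m₀ m₁ m₂ m₃ m₄ → let d = + 1 + f ; K = c + f + + 1 in
      (d ^ 4 * m₄ + (- (+ 2 * d ^ 3 * (+ 3 * d + + 2 * K)) * m₃ + (d ^ 2 * (+ 7 * d ^ 2 + + 12 * d * K + + 6 * K ^ 2) * m₂
        + (- (d * (d ^ 3 + + 4 * d ^ 2 * K + + 6 * d * K ^ 2 + + 4 * K ^ 3)) * m₁ + K ^ 4 * m₀))))
        * ((+ 1 + d) * (+ 2 + d) * (+ 3 + d))
      ≡ m₀ * ((c + f + + 1) * c * f
              * (+ 9 * c * c * f * f + + 9 * c * f * f * f + f * f * f * f - + 3 * c * c * f + + 6 * c * f * f
                 - + 3 * f * f * f + + 6 * c * c + + 3 * c * f - + 9 * f * f + + 6 * c - + 5 * f))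
        + (d ^ 3 * (m₄ * (d * (d + + 1) * (d + + 2) * (d + + 3)) - + 24 * m₀ * (K * (K + + 1) * (K + + 2) * (K + + 3)))
        + (- (+ 2 * d ^ 2 * (+ 3 * d + + 2 * K) * (d + + 3)) * (m₃ * (d * (d + + 1) * (d + + 2)) - + 6 * m₀ * (K * (K + + 1) * (K + + 2)))
        + (d * (+ 7 * d ^ 2 + + 12 * d * K + + 6 * K ^ 2) * (d + + 2) * (d + + 3) * (m₂ * (d * (d + + 1)) - + 2 * m₀ * (K * (K + + 1)))
        + - ((d ^ 3 + + 4 * d ^ 2 * K + + 6 * d * K ^ 2 + + 4 * K ^ 3) * (d + + 1) * (d + + 2) * (d + + 3)) * (m₁ * d - + 1 * m₀ * K))))
    certificate = solve-∀

  third-numerator fourth-numerator : ℕ → ℕ → ℤ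
  third-numerator c f = z (c ℕ.+ f ℕ.+ 1) * z c * z f * (z 2 * z c * z f + z f * z f - z 2 * z c - z 1)
  fourth-numerator c f = z (c ℕ.+ f ℕ.+ 1) * C * F
    * (z 9 * C * C * F * F + z 9 * C * F * F * F + F * F * F * F - z 3 * C * C * F + z 6 * C * F * F - z 3 * F * F * F
       + z 6 * C * C + z 3 * C * F - z 9 * F * F + z 6 * C - z 5 * F)
    where
    C F : ℤ
    C = z c
    F = z f

  module _ (c f : ℕ) (1≤f : 1 ≤ f) where

    moment : ℕ → ℤ
    moment j = ∑ℤ (λ M → (+ requests M c) ↑ℤ j) (injections c (c ℕ.+ f))

    private
      moment≡ : ∀ j → moment j ≡ + ∑ (λ M → requests M c ↑ j) (injections c (c ℕ.+ f))
      moment≡ j = trans (∑ℤ-cong (λ M → sym (+-↑ (requests M c) j)) (injections c (c ℕ.+ f)))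
                        (∑ℤ-pos _ (injections c (c ℕ.+ f)))

    moment-zero : moment 0 ≡ + length (injections c (c ℕ.+ f))
    moment-zero = trans (moment≡ 0) (cong +_ (∑-const-1 (injections c (c ℕ.+ f))))

    moment-rising : ∀ j → moment j * (+ suc f) ↑ℤ j ≡ (+ 1) ↑ℤ j * moment 0 * (+ (c ℕ.+ f ℕ.+ 1)) ↑ℤ j
    moment-rising j = begin
      moment j * (+ suc f) ↑ℤ j
        ≡⟨ cong₂ _*_ (moment≡ j) (sym (+-↑ (suc f) j)) ⟩
      + S * + (suc f ↑ j)
        ≡⟨ ℤP.pos-* S (suc f ↑ j) ⟨
      + (S ℕ.* suc f ↑ j)
        ≡⟨ cong +_ (rising-moment c f 1≤f j) ⟩
      + (1 ↑ j ℕ.* N ℕ.* (c ℕ.+ f ℕ.+ 1) ↑ j)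
        ≡⟨ trans (ℤP.pos-* (1 ↑ j ℕ.* N) ((c ℕ.+ f ℕ.+ 1) ↑ j))
                 (cong (_* + ((c ℕ.+ f ℕ.+ 1) ↑ j)) (ℤP.pos-* (1 ↑ j) N)) ⟩
      + (1 ↑ j) * + N * + ((c ℕ.+ f ℕ.+ 1) ↑ j)
        ≡⟨ cong₂ _*_ (cong₂ _*_ (+-↑ 1 j) (sym moment-zero)) (+-↑ (c ℕ.+ f ℕ.+ 1) j) ⟩
      (+ 1) ↑ℤ j * moment 0 * (+ (c ℕ.+ f ℕ.+ 1)) ↑ℤ j ∎
      where
      open ≡-Reasoning
      S N : ℕ
      S = ∑ (λ M → requests M c ↑ j) (injections c (c ℕ.+ f))
      N = length (injections c (c ℕ.+ f))

    -- deviation M = (f+1) (R − E R), as E R = (c+f+1)/(f+1)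
    deviation : (Fin c → Fin (c ℕ.+ f)) → ℤ
    deviation M = + suc f * + requests M c - + (c ℕ.+ f ℕ.+ 1)

    ∑-deviation³ : ∑ℤ (λ M → deviation M ^ 3) (injections c (c ℕ.+ f)) * (+ suc (suc f) * + suc (suc (suc f)))
                   ≡ moment 0 * third-numerator c f
    ∑-deviation³ = begin
      ∑ℤ (λ M → deviation M ^ 3) xs * D
        ≡⟨ cong (_* D) (∑ℤ-cong (λ M → cube-in-rising-basis d K (+ requests M c)) xs) ⟩
      ∑ℤ (λ M → combination (cube-coefficients d K) (λ i → (+ requests M c) ↑ℤ i)) xs * D
        ≡⟨ cong (_* D) (∑ℤ-combination (cube-coefficients d K) (λ i M → (+ requests M c) ↑ℤ i) xs) ⟩
      combination (cube-coefficients d K) moment * D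
        ≡⟨ cube-moment-identity (+ c) (+ f) moment moment-rising ⟩
      moment 0 * third-numerator c f ∎
      where
      open ≡-Reasoning
      xs : List (Fin c → Fin (c ℕ.+ f))
      xs = injections c (c ℕ.+ f)
      d K D : ℤ
      d = + suc f
      K = + (c ℕ.+ f ℕ.+ 1)
      D = + suc (suc f) * + suc (suc (suc f))

    ∑-deviation⁴ : ∑ℤ (λ M → deviation M ^ 4) (injections c (c ℕ.+ f))
                     * (+ suc (suc f) * + suc (suc (suc f)) * + suc (suc (suc (suc f))))
                   ≡ moment 0 * fourth-numerator c f
    ∑-deviation⁴ = begin
      ∑ℤ (λ M → deviation M ^ 4) xs * D
        ≡⟨ cong (_* D) (∑ℤ-cong (λ M → fourth-power-in-rising-basis d K (+ requests M c)) xs) ⟩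
      ∑ℤ (λ M → combination (fourth-power-coefficients d K) (λ i → (+ requests M c) ↑ℤ i)) xs * D
        ≡⟨ cong (_* D) (∑ℤ-combination (fourth-power-coefficients d K) (λ i M → (+ requests M c) ↑ℤ i) xs) ⟩
      combination (fourth-power-coefficients d K) moment * D
        ≡⟨ fourth-power-moment-identity (+ c) (+ f) moment moment-rising ⟩
      moment 0 * fourth-numerator c f ∎
      where
      open ≡-Reasoning
      xs : List (Fin c → Fin (c ℕ.+ f))
      xs = injections c (c ℕ.+ f)
      d K D : ℤ
      d = + suc f
      K = + (c ℕ.+ f ℕ.+ 1)
      D = + suc (suc f) * + suc (suc (suc f)) * + suc (suc (suc (suc f)))

module Rationals where

  open import Data.Integer as ℤ using (ℤ; +_)
  import Data.Integer.Properties as ℤP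
  open import Data.Integer.Tactic.RingSolver using (ring)
  open import Data.List.Properties using (length-map)
  import Data.Nat.Properties as ℕP
  open import Data.Rational as ℚ using (ℚ; _/_; 1ℚ; _*_; _-_)
  import Data.Rational.Properties as ℚP
  open import Data.Rational.Solver using (module +-*-Solver)
  open import Data.Rational.Unnormalised as ℚᵘ using (mkℚᵘ; *≡*)
  import Data.Rational.Unnormalised.Properties as ℚᵘP
  open import Tactic.RingSolver.Core.AlmostCommutativeRing using (AlmostCommutativeRing)
  open AlmostCommutativeRing ring using (_^_)
  open import Algebra.Properties.CommutativeSemigroup (CommutativeRing.*-commutativeSemigroup ℚP.+-*-commutativeRing)
    using (interchange; xy∙z≈xz∙y)
  open ListSum ℤP.+-*-commutativeSemiring using () renaming (∑ to ∑ℤ)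
  open ListSum (CommutativeRing.commutativeSemiring ℚP.+-*-commutativeRing) using ()
    renaming (∑ to ∑ℚ; ∑-cong to ∑ℚ-cong; ∑-*ʳ to ∑ℚ-*ʳ)

  toℚ : ℤ → ℚ
  toℚ i = i / 1

  private
    toℚᵘ-toℚ : ∀ i → ℚ.toℚᵘ (toℚ i) ℚᵘ.≃ mkℚᵘ i 0
    toℚᵘ-toℚ i = ℚP.toℚᵘ-fromℚᵘ (mkℚᵘ i 0)

  toℚ-+ : ∀ i j → toℚ (i ℤ.+ j) ≡ toℚ i ℚ.+ toℚ j
  toℚ-+ i j = ℚP.toℚᵘ-injective (ℚᵘP.≃-trans (toℚᵘ-toℚ (i ℤ.+ j)) (ℚᵘP.≃-sym
    (ℚᵘP.≃-trans (ℚP.toℚᵘ-homo-+ (toℚ i) (toℚ j)) (ℚᵘP.≃-trans (ℚᵘP.+-cong (toℚᵘ-toℚ i) (toℚᵘ-toℚ j))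
      (ℚᵘP.≃-sym (*≡* (trans (ℤP.*-identityʳ (i ℤ.+ j))
        (sym (trans (ℤP.*-identityʳ _) (cong₂ ℤ._+_ (ℤP.*-identityʳ i) (ℤP.*-identityʳ j)))))))))))

  toℚ-* : ∀ i j → toℚ (i ℤ.* j) ≡ toℚ i * toℚ j
  toℚ-* i j = ℚP.toℚᵘ-injective (ℚᵘP.≃-trans (toℚᵘ-toℚ (i ℤ.* j)) (ℚᵘP.≃-sym
    (ℚᵘP.≃-trans (ℚP.toℚᵘ-homo-* (toℚ i) (toℚ j)) (ℚᵘP.*-cong (toℚᵘ-toℚ i) (toℚᵘ-toℚ j)))))

  toℚ-neg : ∀ i → toℚ (ℤ.- i) ≡ ℚ.- toℚ i
  toℚ-neg i = ℚP.toℚᵘ-injective (ℚᵘP.≃-trans (toℚᵘ-toℚ (ℤ.- i)) (ℚᵘP.≃-sym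
    (ℚᵘP.≃-trans (ℚP.toℚᵘ-homo‿- (toℚ i)) (ℚᵘP.-‿cong (toℚᵘ-toℚ i)))))

  toℚ-- : ∀ i j → toℚ (i ℤ.- j) ≡ toℚ i - toℚ j
  toℚ-- i j = trans (toℚ-+ i (ℤ.- j)) (cong (toℚ i ℚ.+_) (toℚ-neg j))

  toℚ-^ : ∀ i k → toℚ (i ^ k) ≡ powℚ (toℚ i) k
  toℚ-^ i zero          = refl
  toℚ-^ i (suc zero)    = sym (ℚP.*-identityʳ (toℚ i))
  toℚ-^ i (suc (suc k)) =
    trans (toℚ-* (i ^ suc k) i) (trans (cong (_* toℚ i) (toℚ-^ i (suc k))) (ℚP.*-comm _ (toℚ i)))

  toℚ-∑ : ∀ {A : Set} (h : A → ℤ) xs → toℚ (∑ℤ h xs) ≡ ∑ℚ (toℚ ∘ h) xs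
  toℚ-∑ h []       = refl
  toℚ-∑ h (x ∷ xs) = trans (toℚ-+ (h x) (∑ℤ h xs)) (cong (toℚ (h x) ℚ.+_) (toℚ-∑ h xs))

  toℚ-*-inv : ∀ n → toℚ (+ suc n) * inv n ≡ 1ℚ
  toℚ-*-inv n = ℚP.toℚᵘ-injective (ℚᵘP.≃-trans (ℚP.toℚᵘ-homo-* (toℚ (+ suc n)) (inv n))
    (ℚᵘP.≃-trans (ℚᵘP.*-cong (toℚᵘ-toℚ (+ suc n)) (ℚP.toℚᵘ-fromℚᵘ (mkℚᵘ (+ 1) n)))
      (*≡* (trans (ℤP.*-identityʳ _) (trans (ℤP.*-identityʳ _)
              (sym (trans (ℤP.*-identityˡ _) (cong (λ m → + suc m) (ℕP.+-identityʳ n)))))))))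

  toℚ-cross : ∀ a b c d → a ℤ.* b ≡ c ℤ.* d → toℚ a * toℚ b ≡ toℚ c * toℚ d
  toℚ-cross a b c d ab≡cd = trans (sym (toℚ-* a b)) (trans (cong toℚ ab≡cd) (toℚ-* c d))

  powℚ-* : ∀ a b k → powℚ (a * b) k ≡ powℚ a k * powℚ b k
  powℚ-* a b zero    = sym (ℚP.*-identityˡ 1ℚ)
  powℚ-* a b (suc k) = trans (cong (a * b *_) (powℚ-* a b k)) (interchange a b (powℚ a k) (powℚ b k))

  cross-multiply : ∀ x y s s⁻¹ t t⁻¹ → s * s⁻¹ ≡ 1ℚ → t * t⁻¹ ≡ 1ℚ →
                   x * s ≡ t * y → x * t⁻¹ ≡ y * s⁻¹
  cross-multiply x y s s⁻¹ t t⁻¹ ss⁻¹≡1 tt⁻¹≡1 xs≡ty = begin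
    x * t⁻¹                 ≡⟨ trans (cong (x * t⁻¹ *_) ss⁻¹≡1) (ℚP.*-identityʳ _) ⟨
    x * t⁻¹ * (s * s⁻¹)     ≡⟨ interchange x t⁻¹ s s⁻¹ ⟩
    x * s * (t⁻¹ * s⁻¹)     ≡⟨ cong (_* (t⁻¹ * s⁻¹)) xs≡ty ⟩
    t * y * (t⁻¹ * s⁻¹)     ≡⟨ interchange t y t⁻¹ s⁻¹ ⟩
    t * t⁻¹ * (y * s⁻¹)     ≡⟨ trans (cong (_* (y * s⁻¹)) tt⁻¹≡1) (ℚP.*-identityˡ (y * s⁻¹)) ⟩
    y * s⁻¹                 ∎
    where open ≡-Reasoning

  scaled-deviation : ∀ d u → d * u ≡ 1ℚ → ∀ x k → x - k * u ≡ (d * x - k) * u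
  scaled-deviation d u du≡1 x k = begin
    x - k * u              ≡⟨ cong (_- k * u) (trans (cong (x *_) du≡1) (ℚP.*-identityʳ x)) ⟨
    x * (d * u) - k * u    ≡⟨ solve 4 (λ d u x k → x :* (d :* u) :- k :* u := (d :* x :- k) :* u) refl d u x k ⟩
    (d * x - k) * u        ∎
    where
    open ≡-Reasoning
    open +-*-Solver

  average-map : ∀ {A : Set} (h : A → ℚ) xs {p} → length xs ≡ suc p → average (map h xs) ≡ ∑ℚ h xs * inv p
  average-map h (x ∷ xs) refl rewrite length-map h xs = refl

  central-moment : ∀ {A : Set} (X : A → ℤ) (d K : ℤ) (u : ℚ) xs {p} → length xs ≡ suc p →
                   toℚ d * u ≡ 1ℚ → ∑ℤ X xs ℤ.* d ≡ + suc p ℤ.* K → ∀ k →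
                   average (map (λ x → powℚ (toℚ (X x) - average (map (toℚ ∘ X) xs)) k) xs)
                     ≡ toℚ (∑ℤ (λ x → (d ℤ.* X x ℤ.- K) ^ k) xs) * powℚ u k * inv p
  central-moment {A} X d K u xs {p} |xs|≡ du≡1 ∑X*d≡ k = begin
    average (map (λ x → powℚ (toℚ (X x) - μ) k) xs)
      ≡⟨ average-map _ xs |xs|≡ ⟩
    ∑ℚ (λ x → powℚ (toℚ (X x) - μ) k) xs * inv p
      ≡⟨ cong (_* inv p) (∑ℚ-cong deviation-power xs) ⟩
    ∑ℚ (λ x → toℚ (Z x ^ k) * powℚ u k) xs * inv p
      ≡⟨ cong (_* inv p) (∑ℚ-*ʳ (powℚ u k) (λ x → toℚ (Z x ^ k)) xs) ⟩
    ∑ℚ (λ x → toℚ (Z x ^ k)) xs * powℚ u k * inv p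
      ≡⟨ cong (λ t → t * powℚ u k * inv p) (toℚ-∑ (λ x → Z x ^ k) xs) ⟨
    toℚ (∑ℤ (λ x → Z x ^ k) xs) * powℚ u k * inv p ∎
    where
    open ≡-Reasoning
    μ : ℚ
    μ = average (map (toℚ ∘ X) xs)
    Z : A → ℤ
    Z x = d ℤ.* X x ℤ.- K

    μ≡ : μ ≡ toℚ K * u
    μ≡ = begin
      μ                        ≡⟨ average-map (toℚ ∘ X) xs |xs|≡ ⟩
      ∑ℚ (toℚ ∘ X) xs * inv p  ≡⟨ cong (_* inv p) (toℚ-∑ X xs) ⟨
      toℚ (∑ℤ X xs) * inv p    ≡⟨ cross-multiply (toℚ (∑ℤ X xs)) (toℚ K) (toℚ d) u (toℚ (+ suc p)) (inv p)
                                    du≡1 (toℚ-*-inv p) (toℚ-cross (∑ℤ X xs) d (+ suc p) K ∑X*d≡) ⟩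
      toℚ K * u                ∎

    deviation-power : ∀ x → powℚ (toℚ (X x) - μ) k ≡ toℚ (Z x ^ k) * powℚ u k
    deviation-power x = begin
      powℚ (toℚ (X x) - μ) k
        ≡⟨ cong (λ q → powℚ (toℚ (X x) - q) k) μ≡ ⟩
      powℚ (toℚ (X x) - toℚ K * u) k
        ≡⟨ cong (λ q → powℚ q k) (scaled-deviation (toℚ d) u du≡1 (toℚ (X x)) (toℚ K)) ⟩
      powℚ ((toℚ d * toℚ (X x) - toℚ K) * u) k
        ≡⟨ cong (λ q → powℚ (q * u) k) (trans (toℚ-- (d ℤ.* X x) K) (cong (_- toℚ K) (toℚ-* d (X x)))) ⟨
      powℚ (toℚ (Z x) * u) k
        ≡⟨ trans (powℚ-* (toℚ (Z x)) u k) (cong (_* powℚ u k) (sym (toℚ-^ (Z x) k))) ⟩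
      toℚ (Z x ^ k) * powℚ u k ∎

  moment-ratio : ∀ (T P D : ℤ) (U D⁻¹ : ℚ) p → toℚ D * D⁻¹ ≡ 1ℚ → T ℤ.* D ≡ + suc p ℤ.* P →
                 toℚ T * U * inv p ≡ toℚ P * U * D⁻¹
  moment-ratio T P D U D⁻¹ p DD⁻¹≡1 T*D≡ = begin
    toℚ T * U * inv p  ≡⟨ xy∙z≈xz∙y (toℚ T) U (inv p) ⟩
    toℚ T * inv p * U  ≡⟨ cong (_* U) (cross-multiply (toℚ T) (toℚ P) (toℚ D) D⁻¹ (toℚ (+ suc p)) (inv p)
                                         DD⁻¹≡1 (toℚ-*-inv p) (toℚ-cross T D (+ suc p) P T*D≡)) ⟩
    toℚ P * D⁻¹ * U    ≡⟨ xy∙z≈xz∙y (toℚ P) D⁻¹ U ⟩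
    toℚ P * U * D⁻¹    ∎
    where open ≡-Reasoning

  inverse-* : ∀ a a⁻¹ b b⁻¹ → a * a⁻¹ ≡ 1ℚ → b * b⁻¹ ≡ 1ℚ → a * b * (a⁻¹ * b⁻¹) ≡ 1ℚ
  inverse-* a a⁻¹ b b⁻¹ aa⁻¹≡1 bb⁻¹≡1 =
    trans (interchange a b a⁻¹ b⁻¹) (trans (cong₂ _*_ aa⁻¹≡1 bb⁻¹≡1) (ℚP.*-identityˡ 1ℚ))

module CentralMoments (c f : ℕ) (1≤f : 1 ≤ f) where

  open Counting using (injections-nonempty)
  open IntegerMoments
  open Rationals
  open import Data.Integer as ℤ using (ℤ; +_)
  import Data.Integer.Properties as ℤP
  open import Data.Integer.Tactic.RingSolver using (ring)
  import Data.Nat as ℕ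
  open import Data.Rational using (ℚ; 1ℚ; _*_)
  import Data.Rational.Properties as ℚP
  open import Tactic.RingSolver.Core.AlmostCommutativeRing using (AlmostCommutativeRing)
  open AlmostCommutativeRing ring using (_^_)
  open ListSum ℤP.+-*-commutativeSemiring using () renaming (∑ to ∑ℤ)

  private
    p : ℕ
    p = proj₁ (injections-nonempty c f 1≤f)

    moment-zero≡ : moment c f 1≤f 0 ≡ + suc p
    moment-zero≡ = trans (moment-zero c f 1≤f) (cong +_ (proj₂ (injections-nonempty c f 1≤f)))

  central-moment≡ : ∀ k → centralMomentR k c f
    ≡ toℚ (∑ℤ (λ M → deviation c f 1≤f M ^ k) (injections c (c ℕ.+ f))) * powℚ (inv f) k * inv p
  central-moment≡ = central-moment (λ M → + requests M c) (+ suc f) (+ (c ℕ.+ f ℕ.+ 1)) (inv f)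
    (injections c (c ℕ.+ f)) (proj₂ (injections-nonempty c f 1≤f)) (toℚ-*-inv f)
    (trans (moment-rising c f 1≤f 1) (cong (ℤ._* + (c ℕ.+ f ℕ.+ 1)) (trans (ℤP.*-identityˡ _) moment-zero≡)))

  third-central-moment : centralMomentR 3 c f ≡ third c f
  third-central-moment = begin
    centralMomentR 3 c f  ≡⟨ central-moment≡ 3 ⟩
    toℚ T * U * inv p     ≡⟨ moment-ratio T P (d₁ ℤ.* d₂) U (u₁ * u₂) p D-inverse T-ratio ⟩
    toℚ P * U * (u₁ * u₂) ≡⟨ ℚP.*-assoc (toℚ P * U) u₁ u₂ ⟨
    third c f             ∎
    where
    open ≡-Reasoning
    T P d₁ d₂ : ℤ
    T = ∑ℤ (λ M → deviation c f 1≤f M ^ 3) (injections c (c ℕ.+ f))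
    P = third-numerator c f
    d₁ = + suc (suc f)
    d₂ = + suc (suc (suc f))
    U u₁ u₂ : ℚ
    U = powℚ (inv f) 3
    u₁ = inv (suc f)
    u₂ = inv (suc (suc f))
    D-inverse : toℚ (d₁ ℤ.* d₂) * (u₁ * u₂) ≡ 1ℚ
    D-inverse = trans (cong (_* (u₁ * u₂)) (toℚ-* d₁ d₂))
                      (inverse-* (toℚ d₁) u₁ (toℚ d₂) u₂ (toℚ-*-inv (suc f)) (toℚ-*-inv (suc (suc f))))
    T-ratio : T ℤ.* (d₁ ℤ.* d₂) ≡ + suc p ℤ.* P
    T-ratio = trans (∑-deviation³ c f 1≤f) (cong (ℤ._* P) moment-zero≡)

  fourth-central-moment : centralMomentR 4 c f ≡ fourth c f
  fourth-central-moment = begin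
    centralMomentR 4 c f        ≡⟨ central-moment≡ 4 ⟩
    toℚ T * U * inv p           ≡⟨ moment-ratio T P (d₁ ℤ.* d₂ ℤ.* d₃) U (u₁ * u₂ * u₃) p D-inverse T-ratio ⟩
    toℚ P * U * (u₁ * u₂ * u₃)  ≡⟨ ℚP.*-assoc (toℚ P * U) (u₁ * u₂) u₃ ⟨
    toℚ P * U * (u₁ * u₂) * u₃  ≡⟨ cong (_* u₃) (ℚP.*-assoc (toℚ P * U) u₁ u₂) ⟨
    fourth c f                  ∎
    where
    open ≡-Reasoning
    T P d₁ d₂ d₃ : ℤ
    T = ∑ℤ (λ M → deviation c f 1≤f M ^ 4) (injections c (c ℕ.+ f))
    P = fourth-numerator c f
    d₁ = + suc (suc f)
    d₂ = + suc (suc (suc f))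
    d₃ = + suc (suc (suc (suc f)))
    U u₁ u₂ u₃ : ℚ
    U = powℚ (inv f) 4
    u₁ = inv (suc f)
    u₂ = inv (suc (suc f))
    u₃ = inv (suc (suc (suc f)))
    D-inverse : toℚ (d₁ ℤ.* d₂ ℤ.* d₃) * (u₁ * u₂ * u₃) ≡ 1ℚ
    D-inverse = trans (cong (_* (u₁ * u₂ * u₃)) (trans (toℚ-* (d₁ ℤ.* d₂) d₃) (cong (_* toℚ d₃) (toℚ-* d₁ d₂))))
      (inverse-* (toℚ d₁ * toℚ d₂) (u₁ * u₂) (toℚ d₃) u₃
        (inverse-* (toℚ d₁) u₁ (toℚ d₂) u₂ (toℚ-*-inv (suc f)) (toℚ-*-inv (suc (suc f))))
        (toℚ-*-inv (suc (suc (suc f)))))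
    T-ratio : T ℤ.* (d₁ ℤ.* d₂ ℤ.* d₃) ≡ + suc p ℤ.* P
    T-ratio = trans (∑-deviation⁴ c f 1≤f) (cong (ℤ._* P) moment-zero≡)

mainTheorem2 : (c f : ℕ) → 1 ≤ f →
    (centralMomentR 3 c f ≡ third c f) × (centralMomentR 4 c f ≡ fourth c f)
mainTheorem2 c f 1≤f = third-central-moment , fourth-central-moment
  where open CentralMoments c f 1≤f
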